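{- Let $m, n, k, l, t, r$ be positive integers such that $t\geq 2$, $k\geq l \geq t+r$ and $\min\{m, n\}\geq k+l-t+2$. Let $i,j\in [\max \{ m, n\}]$ with $i<j$. Let $\mathcal{A}\subseteq\binom{[n]}{k}$ and $\mathcal{B}\subseteq\binom{[m]}{l}$ be cross-$t$-intersecting families. Suppose there exists a $(t+2r)$-element subset $T\subset [\min\{m, n\}]$ such that \[S_{ij}(\mathcal{A})=\left\{A \in \binom{[n]}{k} : |A \cap T| \geq t+r \right\},\qquad S_{ij}(\mathcal{B})=\left\{B \in \binom{[m]}{l} : |B \cap T| \geq t+r \right\}.\] Then there exists a $(t+2r)$-element subset $T'\subset [\min\{m, n\}]$ such that \[\mathcal{A}=\left\{A \in \binom{[n]}{k} : |A \cap T'| \geq t+r \right\}\quad\text{and}\quad \mathcal{B}=\left\{B \in \binom{[m]}{l} : |B \cap T'| \geq t+r \right\}.\]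
   Context: $[n]=\{1,\dots,n\}$; $\binom{X}{k}$ is the family of $k$-element subsets of $X$. Families $\mathcal{A},\mathcal{B}$ are cross-$t$-intersecting if $|A\cap B|\geq t$ for all $A\in\mathcal{A}$, $B\in\mathcal{B}$. For a family $\mathcal{F}$ of sets and indices $i,j$, the shift operation is defined for $F\in\mathcal{F}$ by $S_{ij}(F)=(F\setminus\{j\})\cup\{i\}$ if $j\in F$, $i\notin F$ and $(F\setminus\{j\})\cup\{i\}\notin\mathcal{F}$, and $S_{ij}(F)=F$ otherwise; and $S_{ij}(\mathcal{F})=\{S_{ij}(F):F\in\mathcal{F}\}$. -}

module Defs where

open import Data.Nat.Base using (ℕ; _<_; _≤_)
open import Data.Bool.Base using (Bool; true; false; _∧_; not; if_then_else_)
open import Data.Fin.Base using (Fin; toℕ)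
open import Data.Fin.Subset using (Subset; _∈_; _∩_; _∪_; _-_; ⁅_⁆; ∣_∣)
open import Data.Vec.Base using (lookup)
open import Data.Product.Base using (Σ; _×_; ∃)
open import Relation.Binary.PropositionalEquality using (_≡_)

-- All sets live inside a common ambient ground set Fin N (0-based);
-- [n] is represented by {x : Fin N | toℕ x < n}.

Family : ℕ → Set
Family N = Subset N → Bool

_∈F_ : {N : ℕ} → Subset N → Family N → Set
F ∈F 𝓕 = 𝓕 F ≡ true

InRange : {N : ℕ} → ℕ → Subset N → Set
InRange n A = ∀ x → x ∈ A → toℕ x < n

InBinom : {N : ℕ} → ℕ → ℕ → Subset N → Set
InBinom n k A = InRange n A × ∣ A ∣ ≡ k

CrossInt : {N : ℕ} → ℕ → Family N → Family N → Set
CrossInt t 𝓐 𝓑 = ∀ A B → A ∈F 𝓐 → B ∈F 𝓑 → t ≤ ∣ A ∩ B ∣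

shiftSet : {N : ℕ} → Fin N → Fin N → Family N → Subset N → Subset N
shiftSet i j 𝓕 F =
  let F' = (F - j) ∪ ⁅ i ⁆ in
  if lookup F j ∧ not (lookup F i) ∧ not (𝓕 F') then F' else F

_∈Shift[_,_]_ : {N : ℕ} → Subset N → Fin N → Fin N → Family N → Set
G ∈Shift[ i , j ] 𝓕 = ∃ λ F → F ∈F 𝓕 × shiftSet i j 𝓕 F ≡ G

InHilton : {N : ℕ} → ℕ → ℕ → Subset N → ℕ → Subset N → Set
InHilton n k T s A = InBinom n k A × s ≤ ∣ A ∩ T ∣

{-# OPTIONS --safe #-}
-- Write s = t + r and 𝓗(T) for the sets meeting T in at least s points. If i ∈ T implies
-- j ∈ T, replacing j by i never increases |F ∩ T|, and 𝓐, 𝓑 already equal their shifts.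
-- Otherwise call G critical if i ∈ G, j ∉ G and |G ∩ T| = s. A family whose shift is 𝓗(T)
-- agrees with 𝓗(T) except that, for each critical G, it may contain G [ i ↦ j ] instead of
-- G; so it is 𝓗(T) if it contains every critical set and 𝓗(T [ i ↦ j ]) if it contains none.
-- Cross-t-intersection gives critical G (for 𝓐) and B (for 𝓑) with |G ∩ B| ≤ t the same
-- status, as G [ i ↦ j ] meets B in one point fewer than G does. The bound
-- min(m, n) ≥ k + l − t + 2 leaves room to build a critical set for the other family close
-- to any critical set, even to two critical sets differing by one exchange of points on
-- the same side of T; such exchanges connect all critical sets, so they share one status.
module Submission where

open import Defs
open import Data.Bool.Base using (true; false)
open import Data.Bool.Properties using (not-¬)
open import Data.Empty using (⊥-elim)
open import Data.Fin.Base using (Fin; zero; suc; toℕ; _<_)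
open import Data.Fin.Properties using (_≟_; <⇒≢)
open import Data.Fin.Subset
open import Data.Fin.Subset.Properties
open import Data.Nat.Base as ℕ using (ℕ; zero; suc; _+_; _*_; _∸_; _≤_; _⊔_; _⊓_; z≤n; s≤s)
open import Data.Nat.Properties hiding (_≟_; <⇒≢)
open import Algebra.Properties.CommutativeSemigroup +-commutativeSemigroup using (xy∙z≈xz∙y)
open import Data.Nat.Tactic.RingSolver using (solve-∀)
open import Data.Product.Base using (Σ; ∃-syntax; _×_; _,_; proj₁; proj₂; uncurry)
open import Data.Sum.Base using (_⊎_; inj₁; inj₂)
open import Data.Vec.Base using ([]; _∷_; here; there; lookup)
open import Data.Vec.Properties using (lookup⇒[]=; []=⇒lookup)
open import Function.Base using (_∘_; const)
open import Function.Bundles using (_⇔_; mk⇔; Equivalence)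
open import Relation.Binary.PropositionalEquality
open import Relation.Nullary using (yes; no; contradiction)

private variable
  N : ℕ
  x y z : Fin N
  p q : Subset N

-- Membership and cardinality of finite subsets

x∈p─q⇒x∉q : ∀ (p q : Subset N) → x ∈ p ─ q → x ∉ q
x∈p─q⇒x∉q (_ ∷ p) (outside ∷ q) here ()
x∈p─q⇒x∉q (_ ∷ p) (_ ∷ q) (there x∈p─q) (there x∈q) = x∈p─q⇒x∉q p q x∈p─q x∈q

⁅x⁆⊆p : x ∈ p → ⁅ x ⁆ ⊆ p
⁅x⁆⊆p {x = x} x∈p y∈⁅x⁆ rewrite x∈⁅y⁆⇒x≡y x y∈⁅x⁆ = x∈p

x∈p×y∉p⊎x∈p⇒y∈p : ∀ x y (p : Subset N) → (x ∈ p × y ∉ p) ⊎ (x ∈ p → y ∈ p)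
x∈p×y∉p⊎x∈p⇒y∈p x y p with x ∈? p | y ∈? p
... | yes x∈p | no y∉p  = inj₁ (x∈p , y∉p)
... | _       | yes y∈p = inj₂ (const y∈p)
... | no  x∉p | _       = inj₂ (λ x∈p → contradiction x∈p x∉p)

∣p∩q∣≡∣q∩p∣ : ∀ (p q : Subset N) → ∣ p ∩ q ∣ ≡ ∣ q ∩ p ∣
∣p∩q∣≡∣q∩p∣ p q = cong ∣_∣ (∩-comm p q)

∣p∩q∣+∣p∩∁q∣≡∣p∣ : ∀ (p q : Subset N) → ∣ p ∩ q ∣ + ∣ p ∩ ∁ q ∣ ≡ ∣ p ∣
∣p∩q∣+∣p∩∁q∣≡∣p∣ []            []            = refl
∣p∩q∣+∣p∩∁q∣≡∣p∣ (inside  ∷ p) (inside  ∷ q) = cong suc (∣p∩q∣+∣p∩∁q∣≡∣p∣ p q)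
∣p∩q∣+∣p∩∁q∣≡∣p∣ (inside  ∷ p) (outside ∷ q) = trans (+-suc _ _) (cong suc (∣p∩q∣+∣p∩∁q∣≡∣p∣ p q))
∣p∩q∣+∣p∩∁q∣≡∣p∣ (outside ∷ p) (_       ∷ q) = ∣p∩q∣+∣p∩∁q∣≡∣p∣ p q

∣p∪q∣+∣p∩q∣≡∣p∣+∣q∣ : ∀ (p q : Subset N) → ∣ p ∪ q ∣ + ∣ p ∩ q ∣ ≡ ∣ p ∣ + ∣ q ∣
∣p∪q∣+∣p∩q∣≡∣p∣+∣q∣ []            []            = refl
∣p∪q∣+∣p∩q∣≡∣p∣+∣q∣ (inside  ∷ p) (inside  ∷ q) =
  cong suc (trans (+-suc _ _) (trans (cong suc (∣p∪q∣+∣p∩q∣≡∣p∣+∣q∣ p q)) (sym (+-suc _ _))))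
∣p∪q∣+∣p∩q∣≡∣p∣+∣q∣ (inside  ∷ p) (outside ∷ q) = cong suc (∣p∪q∣+∣p∩q∣≡∣p∣+∣q∣ p q)
∣p∪q∣+∣p∩q∣≡∣p∣+∣q∣ (outside ∷ p) (inside  ∷ q) =
  trans (cong suc (∣p∪q∣+∣p∩q∣≡∣p∣+∣q∣ p q)) (sym (+-suc _ _))
∣p∪q∣+∣p∩q∣≡∣p∣+∣q∣ (outside ∷ p) (outside ∷ q) = ∣p∪q∣+∣p∩q∣≡∣p∣+∣q∣ p q

Empty⇒∣p∣≡0 : Empty p → ∣ p ∣ ≡ 0
Empty⇒∣p∣≡0 {N} empty = trans (cong ∣_∣ (Empty-unique empty)) (∣⊥∣≡0 N)

∣p∪q∣≤∣p∣+∣q∣ : ∀ (p q : Subset N) → ∣ p ∪ q ∣ ≤ ∣ p ∣ + ∣ q ∣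
∣p∪q∣≤∣p∣+∣q∣ p q = ≤-trans (m≤m+n _ _) (≤-reflexive (∣p∪q∣+∣p∩q∣≡∣p∣+∣q∣ p q))

∣p∪q∣≡∣p∣+∣q∣ : ∀ (p q : Subset N) → Empty (p ∩ q) → ∣ p ∪ q ∣ ≡ ∣ p ∣ + ∣ q ∣
∣p∪q∣≡∣p∣+∣q∣ p q disjoint = begin
  ∣ p ∪ q ∣              ≡⟨ sym (+-identityʳ _) ⟩
  ∣ p ∪ q ∣ + 0          ≡⟨ cong (∣ p ∪ q ∣ +_) (sym (Empty⇒∣p∣≡0 disjoint)) ⟩
  ∣ p ∪ q ∣ + ∣ p ∩ q ∣  ≡⟨ ∣p∪q∣+∣p∩q∣≡∣p∣+∣q∣ p q ⟩
  ∣ p ∣ + ∣ q ∣          ∎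
  where open ≡-Reasoning

∣p∪q∣≡∣p∣+e : ∀ (p q : Subset N) {c e} → ∣ q ∩ p ∣ ≡ c → ∣ q ∣ ≡ c + e → ∣ p ∪ q ∣ ≡ ∣ p ∣ + e
∣p∪q∣≡∣p∣+e p q {c} {e} ∣q∩p∣≡c ∣q∣≡c+e = +-cancelʳ-≡ c _ _ (begin
  ∣ p ∪ q ∣ + c            ≡⟨ cong (∣ p ∪ q ∣ +_) (trans (∣p∩q∣≡∣q∩p∣ p q) ∣q∩p∣≡c) ⟨
  ∣ p ∪ q ∣ + ∣ p ∩ q ∣    ≡⟨ ∣p∪q∣+∣p∩q∣≡∣p∣+∣q∣ p q ⟩
  ∣ p ∣ + ∣ q ∣            ≡⟨ cong (∣ p ∣ +_) (trans ∣q∣≡c+e (+-comm c e)) ⟩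
  ∣ p ∣ + (e + c)          ≡⟨ +-assoc ∣ p ∣ e c ⟨
  ∣ p ∣ + e + c            ∎)
  where open ≡-Reasoning

∣p∩q∣+∣r∣≤∣p∣+∣q∩r∣ : ∀ (p q r : Subset N) → p ⊆ r → r ⊆ p ∪ q → ∣ p ∩ q ∣ + ∣ r ∣ ≤ ∣ p ∣ + ∣ q ∩ r ∣
∣p∩q∣+∣r∣≤∣p∣+∣q∩r∣ p q r p⊆r r⊆p∪q = begin
  ∣ p ∩ q ∣ + ∣ r ∣                      ≤⟨ +-mono-≤ (p⊆q⇒∣p∣≤∣q∣ p∩q⊆p∩[q∩r]) (p⊆q⇒∣p∣≤∣q∣ r⊆p∪[q∩r]) ⟩
  ∣ p ∩ (q ∩ r) ∣ + ∣ p ∪ (q ∩ r) ∣      ≡⟨ +-comm ∣ p ∩ (q ∩ r) ∣ _ ⟩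
  ∣ p ∪ (q ∩ r) ∣ + ∣ p ∩ (q ∩ r) ∣      ≡⟨ ∣p∪q∣+∣p∩q∣≡∣p∣+∣q∣ p (q ∩ r) ⟩
  ∣ p ∣ + ∣ q ∩ r ∣                      ∎
  where
  open ≤-Reasoning
  p∩q⊆p∩[q∩r] : p ∩ q ⊆ p ∩ (q ∩ r)
  p∩q⊆p∩[q∩r] z∈ = let z∈p , z∈q = x∈p∩q⁻ p q z∈ in x∈p∩q⁺ (z∈p , x∈p∩q⁺ (z∈q , p⊆r z∈p))
  r⊆p∪[q∩r] : r ⊆ p ∪ (q ∩ r)
  r⊆p∪[q∩r] z∈r with x∈p∪q⁻ p q (r⊆p∪q z∈r)
  ... | inj₁ z∈p = x∈p∪q⁺ (inj₁ z∈p)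
  ... | inj₂ z∈q = x∈p∪q⁺ (inj₂ (x∈p∩q⁺ (z∈q , z∈r)))

∣p∩∁q∣≡∣q∩∁p∣ : ∀ (p q : Subset N) → ∣ p ∣ ≡ ∣ q ∣ → ∣ p ∩ ∁ q ∣ ≡ ∣ q ∩ ∁ p ∣
∣p∩∁q∣≡∣q∩∁p∣ p q ∣p∣≡∣q∣ = +-cancelˡ-≡ ∣ p ∩ q ∣ _ _ (begin
  ∣ p ∩ q ∣ + ∣ p ∩ ∁ q ∣  ≡⟨ ∣p∩q∣+∣p∩∁q∣≡∣p∣ p q ⟩
  ∣ p ∣                    ≡⟨ ∣p∣≡∣q∣ ⟩
  ∣ q ∣                    ≡⟨ sym (∣p∩q∣+∣p∩∁q∣≡∣p∣ q p) ⟩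
  ∣ q ∩ p ∣ + ∣ q ∩ ∁ p ∣  ≡⟨ cong (_+ ∣ q ∩ ∁ p ∣) (∣p∩q∣≡∣q∩p∣ q p) ⟩
  ∣ p ∩ q ∣ + ∣ q ∩ ∁ p ∣  ∎)
  where open ≡-Reasoning

x∈p⇒0<∣p∣ : x ∈ p → 0 ℕ.< ∣ p ∣
x∈p⇒0<∣p∣ {x = x} x∈p = subst (ℕ._≤ _) (∣⁅x⁆∣≡1 x) (p⊆q⇒∣p∣≤∣q∣ (⁅x⁆⊆p x∈p))

0<∣p∣⇒Nonempty : 0 ℕ.< ∣ p ∣ → Nonempty p
0<∣p∣⇒Nonempty {p = p} 0<∣p∣ with nonempty? p
... | yes nonempty = nonempty
... | no  empty    = contradiction (Empty⇒∣p∣≡0 empty) (n>0⇒n≢0 0<∣p∣)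

∣p∩∁q∣≡0⇒p⊆q : ∀ (p q : Subset N) → ∣ p ∩ ∁ q ∣ ≡ 0 → p ⊆ q
∣p∩∁q∣≡0⇒p⊆q p q ∣p∩∁q∣≡0 {x} x∈p with x ∈? q
... | yes x∈q = x∈q
... | no  x∉q = contradiction ∣p∩∁q∣≡0 (n>0⇒n≢0 (x∈p⇒0<∣p∣ (x∈p∩q⁺ (x∈p , x∉p⇒x∈∁p x∉q))))

∣p∩∁q∣≡0⇒p≡q : ∀ (p q : Subset N) → ∣ p ∣ ≡ ∣ q ∣ → ∣ p ∩ ∁ q ∣ ≡ 0 → p ≡ q
∣p∩∁q∣≡0⇒p≡q p q ∣p∣≡∣q∣ ∣p∩∁q∣≡0 = ⊆-antisym (∣p∩∁q∣≡0⇒p⊆q p q ∣p∩∁q∣≡0)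
  (∣p∩∁q∣≡0⇒p⊆q q p (trans (sym (∣p∩∁q∣≡∣q∩∁p∣ p q ∣p∣≡∣q∣)) ∣p∩∁q∣≡0))

∣⁅x⁆∩p∣≡1 : x ∈ p → ∣ ⁅ x ⁆ ∩ p ∣ ≡ 1
∣⁅x⁆∩p∣≡1 {x = x} {p = p} x∈p = trans (cong ∣_∣ ⁅x⁆∩p≡⁅x⁆) (∣⁅x⁆∣≡1 x)
  where
  ⁅x⁆∩p≡⁅x⁆ : ⁅ x ⁆ ∩ p ≡ ⁅ x ⁆
  ⁅x⁆∩p≡⁅x⁆ = ⊆-antisym (p∩q⊆p _ _) (λ y∈⁅x⁆ → x∈p∩q⁺ (y∈⁅x⁆ , ⁅x⁆⊆p x∈p y∈⁅x⁆))

∣⁅x⁆∩p∣≡0 : x ∉ p → ∣ ⁅ x ⁆ ∩ p ∣ ≡ 0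
∣⁅x⁆∩p∣≡0 {x = x} {p = p} x∉p = Empty⇒∣p∣≡0 λ (y , y∈) →
  let y∈⁅x⁆ , y∈p = x∈p∩q⁻ _ _ y∈ in x∉p (subst (_∈ p) (x∈⁅y⁆⇒x≡y x y∈⁅x⁆) y∈p)

∣⁅x⁆∩p∣≤1 : ∀ (x : Fin N) p → ∣ ⁅ x ⁆ ∩ p ∣ ≤ 1
∣⁅x⁆∩p∣≤1 x p = subst (∣ ⁅ x ⁆ ∩ p ∣ ≤_) (∣⁅x⁆∣≡1 x) (∣p∩q∣≤∣p∣ ⁅ x ⁆ p)

partner : ∀ (p q X : Subset N) → ∣ p ∩ X ∣ ≡ ∣ q ∩ X ∣ → x ∈ p → x ∉ q → x ∈ X →
          ∃[ y ] y ∈ q × y ∉ p × y ∈ X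
partner {x = x} p q X ∣p∩X∣≡∣q∩X∣ x∈p x∉q x∈X =
  let y , y∈q∩X∩∁[p∩X] = 0<∣p∣⇒Nonempty (subst (0 ℕ.<_) balanced (x∈p⇒0<∣p∣ x∈p∩X∩∁[q∩X]))
      y∈q∩X , y∈∁[p∩X] = x∈p∩q⁻ _ _ y∈q∩X∩∁[p∩X]
      y∈q , y∈X = x∈p∩q⁻ _ _ y∈q∩X
  in  y , y∈q , (λ y∈p → x∈∁p⇒x∉p y∈∁[p∩X] (x∈p∩q⁺ (y∈p , y∈X))) , y∈X
  where
  balanced : ∣ (p ∩ X) ∩ ∁ (q ∩ X) ∣ ≡ ∣ (q ∩ X) ∩ ∁ (p ∩ X) ∣
  balanced = ∣p∩∁q∣≡∣q∩∁p∣ (p ∩ X) (q ∩ X) ∣p∩X∣≡∣q∩X∣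
  x∈p∩X∩∁[q∩X] : x ∈ (p ∩ X) ∩ ∁ (q ∩ X)
  x∈p∩X∩∁[q∩X] = x∈p∩q⁺ (x∈p∩q⁺ (x∈p , x∈X) , x∉p⇒x∈∁p (x∉q ∘ proj₁ ∘ x∈p∩q⁻ _ _))

same-side-partner : ∀ (p q T : Subset N) → ∣ p ∣ ≡ ∣ q ∣ → ∣ p ∩ T ∣ ≡ ∣ q ∩ T ∣ → x ∈ p → x ∉ q →
                    ∃[ y ] y ∈ q × y ∉ p × ∣ ⁅ x ⁆ ∩ T ∣ ≡ ∣ ⁅ y ⁆ ∩ T ∣
same-side-partner {x = x} p q T ∣p∣≡∣q∣ ∣p∩T∣≡∣q∩T∣ x∈p x∉q with x ∈? T
... | yes x∈T = let y , y∈q , y∉p , y∈T = partner p q T ∣p∩T∣≡∣q∩T∣ x∈p x∉q x∈T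
                in  y , y∈q , y∉p , trans (∣⁅x⁆∩p∣≡1 x∈T) (sym (∣⁅x⁆∩p∣≡1 y∈T))
... | no  x∉T = let y , y∈q , y∉p , y∈∁T = partner p q (∁ T) ∣p∩∁T∣≡∣q∩∁T∣ x∈p x∉q (x∉p⇒x∈∁p x∉T)
                in  y , y∈q , y∉p , trans (∣⁅x⁆∩p∣≡0 x∉T) (sym (∣⁅x⁆∩p∣≡0 (x∈∁p⇒x∉p y∈∁T)))
  where
  ∣p∩∁T∣≡∣q∩∁T∣ : ∣ p ∩ ∁ T ∣ ≡ ∣ q ∩ ∁ T ∣
  ∣p∩∁T∣≡∣q∩∁T∣ = +-cancelˡ-≡ ∣ p ∩ T ∣ _ _ (begin
    ∣ p ∩ T ∣ + ∣ p ∩ ∁ T ∣  ≡⟨ ∣p∩q∣+∣p∩∁q∣≡∣p∣ p T ⟩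
    ∣ p ∣                    ≡⟨ ∣p∣≡∣q∣ ⟩
    ∣ q ∣                    ≡⟨ ∣p∩q∣+∣p∩∁q∣≡∣p∣ q T ⟨
    ∣ q ∩ T ∣ + ∣ q ∩ ∁ T ∣  ≡⟨ cong (_+ ∣ q ∩ ∁ T ∣) ∣p∩T∣≡∣q∩T∣ ⟨
    ∣ p ∩ T ∣ + ∣ q ∩ ∁ T ∣  ∎)
    where open ≡-Reasoning

subset-between : ∀ (p q : Subset N) c → p ⊆ q → ∣ p ∣ ≤ c → c ≤ ∣ q ∣ →
                 ∃[ w ] p ⊆ w × w ⊆ q × ∣ w ∣ ≡ c
subset-between []            []            zero    _   _         _         = [] , (λ ()) , (λ ()) , refl
subset-between (inside  ∷ p) (outside ∷ q) c       p⊆q _         _         with p⊆q here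
... | ()
subset-between (inside  ∷ p) (inside  ∷ q) (suc c) p⊆q (s≤s ∣p∣≤c) (s≤s c≤∣q∣) =
  let w , p⊆w , w⊆q , ∣w∣≡c = subset-between p q c (drop-∷-⊆ p⊆q) ∣p∣≤c c≤∣q∣
  in  inside ∷ w , in⊆in p⊆w , in⊆in w⊆q , cong suc ∣w∣≡c
subset-between (outside ∷ p) (outside ∷ q) c       p⊆q ∣p∣≤c     c≤∣q∣     =
  let w , p⊆w , w⊆q , ∣w∣≡c = subset-between p q c (drop-∷-⊆ p⊆q) ∣p∣≤c c≤∣q∣
  in  outside ∷ w , out⊆ p⊆w , out⊆ w⊆q , ∣w∣≡c
subset-between (outside ∷ p) (inside  ∷ q) c       p⊆q ∣p∣≤c     c≤1+∣q∣   with c ≤? ∣ q ∣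
... | yes c≤∣q∣ =
  let w , p⊆w , w⊆q , ∣w∣≡c = subset-between p q c (drop-∷-⊆ p⊆q) ∣p∣≤c c≤∣q∣
  in  outside ∷ w , out⊆ p⊆w , out⊆ w⊆q , ∣w∣≡c
... | no  c≰∣q∣ = inside ∷ q , out⊆ (drop-∷-⊆ p⊆q) , ⊆-refl , ≤-antisym (≰⇒> c≰∣q∣) c≤1+∣q∣

below : ℕ → Subset N
below {zero}  _       = []
below {suc N} zero    = outside ∷ below zero
below {suc N} (suc u) = inside ∷ below u

∣below∣ : ∀ {u} → u ≤ N → ∣ below {N} u ∣ ≡ u
∣below∣ {zero}  {zero}  z≤n       = refl
∣below∣ {suc N} {zero}  z≤n       = ∣below∣ {N} z≤n
∣below∣ {suc N} {suc u} (s≤s u≤N) = cong suc (∣below∣ u≤N)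

∈below⁺ : ∀ {u} → toℕ x ℕ.< u → x ∈ below u
∈below⁺ {x = zero}  {u = suc u} _          = here
∈below⁺ {x = suc x} {u = suc u} (s≤s x<u) = there (∈below⁺ x<u)

∈below⁻ : ∀ {u} → x ∈ below u → toℕ x ℕ.< u
∈below⁻ {x = zero}  {u = suc u} here       = s≤s z≤n
∈below⁻ {x = suc x} {u = zero}  (there x∈) with ∈below⁻ x∈
... | ()
∈below⁻ {x = suc x} {u = suc u} (there x∈) = s≤s (∈below⁻ x∈)

-- Replacing one point of a set

infixl 25 _[_↦_]

_[_↦_] : Subset N → Fin N → Fin N → Subset N
p [ x ↦ y ] = (p - x) ∪ ⁅ y ⁆

x∉p-x : ∀ (p : Subset N) x → x ∉ p - x
x∉p-x p x x∈p-x = x∈p─q⇒x∉q p ⁅ x ⁆ x∈p-x (x∈⁅x⁆ x)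

x∈p-y⇒x∈p∧x≢y : ∀ (p : Subset N) → z ∈ p - x → z ∈ p × z ≢ x
x∈p-y⇒x∈p∧x≢y {x = x} p z∈p-x = p─q⊆p p ⁅ x ⁆ z∈p-x , x∉⁅y⁆⇒x≢y (x∈p─q⇒x∉q p ⁅ x ⁆ z∈p-x)

y∈p[x↦y] : ∀ (p : Subset N) x y → y ∈ p [ x ↦ y ]
y∈p[x↦y] p x y = x∈p∪q⁺ (inj₂ (x∈⁅x⁆ y))

∈[↦]⁺ : z ∈ p → z ≢ x → z ∈ p [ x ↦ y ]
∈[↦]⁺ z∈p z≢x = x∈p∪q⁺ (inj₁ (x∈p∧x≢y⇒x∈p-y z∈p z≢x))

∈[↦]⁻ : ∀ (p : Subset N) → z ∈ p [ x ↦ y ] → (z ∈ p × z ≢ x) ⊎ z ≡ y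
∈[↦]⁻ {x = x} {y = y} p z∈ with x∈p∪q⁻ (p - x) ⁅ y ⁆ z∈
... | inj₁ z∈p-x = inj₁ (x∈p-y⇒x∈p∧x≢y p z∈p-x)
... | inj₂ z∈⁅y⁆ = inj₂ (x∈⁅y⁆⇒x≡y y z∈⁅y⁆)

x∉p[x↦y] : ∀ (p : Subset N) → x ≢ y → x ∉ p [ x ↦ y ]
x∉p[x↦y] p x≢y x∈ with ∈[↦]⁻ p x∈
... | inj₁ (_ , x≢x) = x≢x refl
... | inj₂ x≡y       = x≢y x≡y

[↦]-inverse : ∀ (p : Subset N) → x ∈ p → y ∉ p → p [ x ↦ y ] [ y ↦ x ] ≡ p
[↦]-inverse {x = x} {y = y} p x∈p y∉p = ⊆-antisym ⊆p ⊇p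
  where
  ⊆p : p [ x ↦ y ] [ y ↦ x ] ⊆ p
  ⊆p z∈ with ∈[↦]⁻ (p [ x ↦ y ]) z∈
  ... | inj₂ refl = x∈p
  ... | inj₁ (z∈p[x↦y] , z≢y) with ∈[↦]⁻ p z∈p[x↦y]
  ...   | inj₁ (z∈p , _) = z∈p
  ...   | inj₂ z≡y       = contradiction z≡y z≢y
  ⊇p : p ⊆ p [ x ↦ y ] [ y ↦ x ]
  ⊇p {z} z∈p with z ≟ x
  ... | yes refl = y∈p[x↦y] _ y x
  ... | no  z≢x  = ∈[↦]⁺ (∈[↦]⁺ z∈p z≢x) (λ { refl → y∉p z∈p })

[↦]-self : ∀ (p : Subset N) → x ∈ p → p [ x ↦ x ] ≡ p
[↦]-self {x = x} p x∈p = ⊆-antisym ⊆p ⊇p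
  where
  ⊆p : p [ x ↦ x ] ⊆ p
  ⊆p z∈ with ∈[↦]⁻ p z∈
  ... | inj₁ (z∈p , _) = z∈p
  ... | inj₂ refl      = x∈p
  ⊇p : p ⊆ p [ x ↦ x ]
  ⊇p {z} z∈p with z ≟ x
  ... | yes refl = y∈p[x↦y] p x x
  ... | no  z≢x  = ∈[↦]⁺ z∈p z≢x

∣[↦]∩∣ : ∀ (p X : Subset N) x y → y ∉ p - x → ∣ p [ x ↦ y ] ∩ X ∣ ≡ ∣ (p - x) ∩ X ∣ + ∣ ⁅ y ⁆ ∩ X ∣
∣[↦]∩∣ p X x y y∉p-x =
  trans (cong ∣_∣ (∩-distribʳ-∪ X (p - x) ⁅ y ⁆)) (∣p∪q∣≡∣p∣+∣q∣ _ _ disjoint)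
  where
  disjoint : Empty (((p - x) ∩ X) ∩ (⁅ y ⁆ ∩ X))
  disjoint (z , z∈) =
    let z∈p-x∩X , z∈⁅y⁆∩X = x∈p∩q⁻ _ _ z∈
        z≡y = x∈⁅y⁆⇒x≡y y (proj₁ (x∈p∩q⁻ _ _ z∈⁅y⁆∩X))
    in  y∉p-x (subst (_∈ p - x) z≡y (proj₁ (x∈p∩q⁻ _ _ z∈p-x∩X)))

∣p[x↦y]∩X∣+∣⁅x⁆∩X∣ : ∀ (p X : Subset N) → x ∈ p → y ∉ p →
                     ∣ p [ x ↦ y ] ∩ X ∣ + ∣ ⁅ x ⁆ ∩ X ∣ ≡ ∣ p ∩ X ∣ + ∣ ⁅ y ⁆ ∩ X ∣
∣p[x↦y]∩X∣+∣⁅x⁆∩X∣ {x = x} {y = y} p X x∈p y∉p = begin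
  ∣ p [ x ↦ y ] ∩ X ∣ + ∣ ⁅ x ⁆ ∩ X ∣              ≡⟨ cong (_+ ∣ ⁅ x ⁆ ∩ X ∣) (∣[↦]∩∣ p X x y y∉p-x) ⟩
  ∣ (p - x) ∩ X ∣ + ∣ ⁅ y ⁆ ∩ X ∣ + ∣ ⁅ x ⁆ ∩ X ∣  ≡⟨ xy∙z≈xz∙y ∣ (p - x) ∩ X ∣ _ _ ⟩
  ∣ (p - x) ∩ X ∣ + ∣ ⁅ x ⁆ ∩ X ∣ + ∣ ⁅ y ⁆ ∩ X ∣  ≡⟨ cong (_+ ∣ ⁅ y ⁆ ∩ X ∣) (∣[↦]∩∣ p X x x (x∉p-x p x)) ⟨
  ∣ p [ x ↦ x ] ∩ X ∣ + ∣ ⁅ y ⁆ ∩ X ∣              ≡⟨ cong (λ q → ∣ q ∩ X ∣ + ∣ ⁅ y ⁆ ∩ X ∣) ([↦]-self p x∈p) ⟩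
  ∣ p ∩ X ∣ + ∣ ⁅ y ⁆ ∩ X ∣                        ∎
  where
  open ≡-Reasoning
  y∉p-x : y ∉ p - x
  y∉p-x = y∉p ∘ p─q⊆p p ⁅ x ⁆

∣p[x↦y]∩X∣≤∣p∩X∣+1 : ∀ (p X : Subset N) → x ∈ p → y ∉ p → ∣ p [ x ↦ y ] ∩ X ∣ ≤ ∣ p ∩ X ∣ + 1
∣p[x↦y]∩X∣≤∣p∩X∣+1 {x = x} {y = y} p X x∈p y∉p = begin
  ∣ p [ x ↦ y ] ∩ X ∣                      ≤⟨ m≤m+n _ _ ⟩
  ∣ p [ x ↦ y ] ∩ X ∣ + ∣ ⁅ x ⁆ ∩ X ∣      ≡⟨ ∣p[x↦y]∩X∣+∣⁅x⁆∩X∣ p X x∈p y∉p ⟩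
  ∣ p ∩ X ∣ + ∣ ⁅ y ⁆ ∩ X ∣                ≤⟨ +-monoʳ-≤ ∣ p ∩ X ∣ (∣⁅x⁆∩p∣≤1 y X) ⟩
  ∣ p ∩ X ∣ + 1                            ∎
  where open ≤-Reasoning

∣p[x↦y]∩X∣≤∣p∩X∣ : ∀ (p X : Subset N) → x ∈ p → y ∉ p → (y ∈ X → x ∈ X) → ∣ p [ x ↦ y ] ∩ X ∣ ≤ ∣ p ∩ X ∣
∣p[x↦y]∩X∣≤∣p∩X∣ {x = x} {y = y} p X x∈p y∉p y∈X⇒x∈X with y ∈? X
... | yes y∈X = ≤-reflexive (+-cancelʳ-≡ 1 _ _
      (subst₂ (λ c d → ∣ p [ x ↦ y ] ∩ X ∣ + c ≡ ∣ p ∩ X ∣ + d) (∣⁅x⁆∩p∣≡1 (y∈X⇒x∈X y∈X)) (∣⁅x⁆∩p∣≡1 y∈X)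
        (∣p[x↦y]∩X∣+∣⁅x⁆∩X∣ p X x∈p y∉p)))
... | no  y∉X = ≤-trans (m≤m+n _ _) (≤-reflexive (trans (∣p[x↦y]∩X∣+∣⁅x⁆∩X∣ p X x∈p y∉p)
      (trans (cong (∣ p ∩ X ∣ +_) (∣⁅x⁆∩p∣≡0 y∉X)) (+-identityʳ _))))

∣p[x↦y]∩X∣+1≡∣p∩X∣ : ∀ (p X : Subset N) → x ∈ p → y ∉ p → x ∈ X → y ∉ X → ∣ p [ x ↦ y ] ∩ X ∣ + 1 ≡ ∣ p ∩ X ∣
∣p[x↦y]∩X∣+1≡∣p∩X∣ {x = x} {y = y} p X x∈p y∉p x∈X y∉X = trans
  (subst₂ (λ c d → ∣ p [ x ↦ y ] ∩ X ∣ + c ≡ ∣ p ∩ X ∣ + d) (∣⁅x⁆∩p∣≡1 x∈X) (∣⁅x⁆∩p∣≡0 y∉X)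
    (∣p[x↦y]∩X∣+∣⁅x⁆∩X∣ p X x∈p y∉p))
  (+-identityʳ _)

∣p[x↦y]∩X∣≡∣p∩X∣+1 : ∀ (p X : Subset N) → x ∈ p → y ∉ p → x ∉ X → y ∈ X → ∣ p [ x ↦ y ] ∩ X ∣ ≡ ∣ p ∩ X ∣ + 1
∣p[x↦y]∩X∣≡∣p∩X∣+1 {x = x} {y = y} p X x∈p y∉p x∉X y∈X = trans (sym (+-identityʳ _))
  (subst₂ (λ c d → ∣ p [ x ↦ y ] ∩ X ∣ + c ≡ ∣ p ∩ X ∣ + d) (∣⁅x⁆∩p∣≡0 x∉X) (∣⁅x⁆∩p∣≡1 y∈X)
    (∣p[x↦y]∩X∣+∣⁅x⁆∩X∣ p X x∈p y∉p))

∣p[x↦y]∩X∣≡∣p∩X∣ : ∀ (p X : Subset N) → x ∈ p → y ∉ p → ∣ ⁅ x ⁆ ∩ X ∣ ≡ ∣ ⁅ y ⁆ ∩ X ∣ →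
                   ∣ p [ x ↦ y ] ∩ X ∣ ≡ ∣ p ∩ X ∣
∣p[x↦y]∩X∣≡∣p∩X∣ {x = x} {y = y} p X x∈p y∉p x≈y = +-cancelʳ-≡ ∣ ⁅ y ⁆ ∩ X ∣ _ _
  (subst (λ c → ∣ p [ x ↦ y ] ∩ X ∣ + c ≡ ∣ p ∩ X ∣ + ∣ ⁅ y ⁆ ∩ X ∣) x≈y (∣p[x↦y]∩X∣+∣⁅x⁆∩X∣ p X x∈p y∉p))

∣p[x↦y]∣≡∣p∣ : ∀ (p : Subset N) → x ∈ p → y ∉ p → ∣ p [ x ↦ y ] ∣ ≡ ∣ p ∣
∣p[x↦y]∣≡∣p∣ {x = x} {y = y} p x∈p y∉p = subst₂ (λ a b → ∣ a ∣ ≡ ∣ b ∣) (∩-identityʳ (p [ x ↦ y ])) (∩-identityʳ p)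
  (∣p[x↦y]∩X∣≡∣p∩X∣ p ⊤ x∈p y∉p (trans (∣⁅x⁆∩p∣≡1 (∈⊤ {x = x})) (sym (∣⁅x⁆∩p∣≡1 (∈⊤ {x = y})))))

∣p∩X∣≤∣[p-x]∩X∣+1 : ∀ (p X : Subset N) x → ∣ p ∩ X ∣ ≤ ∣ (p - x) ∩ X ∣ + 1
∣p∩X∣≤∣[p-x]∩X∣+1 p X x = begin
  ∣ p ∩ X ∣                    ≤⟨ p⊆q⇒∣p∣≤∣q∣ p∩X⊆[p-x]∩X∪⁅x⁆ ⟩
  ∣ (p - x) ∩ X ∪ ⁅ x ⁆ ∣      ≤⟨ ∣p∪q∣≤∣p∣+∣q∣ ((p - x) ∩ X) ⁅ x ⁆ ⟩
  ∣ (p - x) ∩ X ∣ + ∣ ⁅ x ⁆ ∣  ≡⟨ cong (∣ (p - x) ∩ X ∣ +_) (∣⁅x⁆∣≡1 x) ⟩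
  ∣ (p - x) ∩ X ∣ + 1          ∎
  where
  open ≤-Reasoning
  p∩X⊆[p-x]∩X∪⁅x⁆ : p ∩ X ⊆ (p - x) ∩ X ∪ ⁅ x ⁆
  p∩X⊆[p-x]∩X∪⁅x⁆ {z} z∈p∩X with z ≟ x | x∈p∩q⁻ p X z∈p∩X
  ... | yes refl | _           = x∈p∪q⁺ (inj₂ (x∈⁅x⁆ x))
  ... | no  z≢x  | z∈p , z∈X = x∈p∪q⁺ (inj₁ (x∈p∩q⁺ (x∈p∧x≢y⇒x∈p-y z∈p z≢x , z∈X)))

InRange-[↦] : ∀ {u} (p : Subset N) → InRange u p → toℕ y ℕ.< u → InRange u (p [ x ↦ y ])
InRange-[↦] p p⊆[u] y<u z z∈ with ∈[↦]⁻ p z∈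
... | inj₁ (z∈p , _) = p⊆[u] z z∈p
... | inj₂ refl      = y<u

InBinom-[↦] : ∀ {u v} (p : Subset N) → x ∈ p → y ∉ p → toℕ y ℕ.< u → InBinom u v p → InBinom u v (p [ x ↦ y ])
InBinom-[↦] p x∈p y∉p y<u (p⊆[u] , ∣p∣≡v) = InRange-[↦] p p⊆[u] y<u , trans (∣p[x↦y]∣≡∣p∣ p x∈p y∉p) ∣p∣≡v

-- The shift S_ij

_∉F_ : Subset N → Family N → Set
A ∉F 𝓕 = 𝓕 A ≡ false

module Shifting {N : ℕ} (i j : Fin N) (𝓕 : Family N) where

  data ShiftView (F : Subset N) : Subset N → Set where
    moved  : j ∈ F → i ∉ F → F [ j ↦ i ] ∉F 𝓕 → ShiftView F (F [ j ↦ i ])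
    stayed : (j ∈ F → i ∉ F → F [ j ↦ i ] ∈F 𝓕) → ShiftView F F

  shiftView : ∀ F → ShiftView F (shiftSet i j 𝓕 F)
  shiftView F with lookup F j in Fj | lookup F i in Fi | 𝓕 (F [ j ↦ i ]) in F′∈?𝓕
  ... | true  | false | false = moved (lookup⇒[]= j F Fj) (λ i∈F → not-¬ ([]=⇒lookup i∈F) Fi) F′∈?𝓕
  ... | true  | false | true  = stayed (λ _ _ → F′∈?𝓕)
  ... | true  | true  | _     = stayed (λ _ i∉F → contradiction (lookup⇒[]= i F Fi) i∉F)
  ... | false | _     | _     = stayed (λ j∈F → contradiction Fj (not-¬ ([]=⇒lookup j∈F)))

  survives-or-moves : ∀ F → F ∈F 𝓕 →
    F ∈Shift[ i , j ] 𝓕 ⊎ (j ∈ F × i ∉ F × F [ j ↦ i ] ∉F 𝓕 × F [ j ↦ i ] ∈Shift[ i , j ] 𝓕)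
  survives-or-moves F F∈𝓕 with shiftSet i j 𝓕 F in shift≡ | shiftView F
  ... | _ | stayed _             = inj₁ (F , F∈𝓕 , shift≡)
  ... | _ | moved j∈F i∉F F′∉𝓕 = inj₂ (j∈F , i∉F , F′∉𝓕 , F , F∈𝓕 , shift≡)

  ∈Shift⇒ : ∀ G → G ∈Shift[ i , j ] 𝓕 →
    (G ∈F 𝓕 × (j ∈ G → i ∉ G → G [ j ↦ i ] ∈F 𝓕)) ⊎ (i ∈ G × j ∉ G × G ∉F 𝓕 × G [ i ↦ j ] ∈F 𝓕)
  ∈Shift⇒ _ (F , F∈𝓕 , refl) with shiftSet i j 𝓕 F | shiftView F
  ... | _ | stayed stays         = inj₁ (F∈𝓕 , stays)
  ... | _ | moved j∈F i∉F F′∉𝓕 =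
    inj₂ (y∈p[x↦y] F j i , x∉p[x↦y] F (λ { refl → i∉F j∈F }) , F′∉𝓕 ,
          subst (_∈F 𝓕) (sym ([↦]-inverse F j∈F i∉F)) F∈𝓕)

-- Critical sets

-- The members of 𝓗(T) whose preimage G [ i ↦ j ] lies outside 𝓗(T) when i ∈ T and j ∉ T.
Critical : ∀ {N} (i j : Fin N) (T : Subset N) (s u v : ℕ) → Subset N → Set
Critical i j T s u v G = InBinom u v G × i ∈ G × j ∉ G × ∣ G ∩ T ∣ ≡ s

Critical⇒Hilton : ∀ {i j : Fin N} {T s u v G} → Critical i j T s u v G → InHilton u v T s G
Critical⇒Hilton (G∈binom , _ , _ , ∣G∩T∣≡s) = G∈binom , ≤-reflexive (sym ∣G∩T∣≡s)

Critical-[↦] : ∀ {i j : Fin N} {T s u v G G′} → Critical i j T s u v G → Critical i j T s u v G′ →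
               x ∈ G → x ∉ G′ → y ∈ G′ → y ∉ G → ∣ ⁅ x ⁆ ∩ T ∣ ≡ ∣ ⁅ y ⁆ ∩ T ∣ → Critical i j T s u v (G [ x ↦ y ])
Critical-[↦] {x = x} {y = y} {j = j} {T = T} {G = G}
             (G∈binom , i∈G , j∉G , ∣G∩T∣≡s) ((G′⊆[u] , _) , i∈G′ , j∉G′ , _) x∈G x∉G′ y∈G′ y∉G x≈y =
  InBinom-[↦] G x∈G y∉G (G′⊆[u] y y∈G′) G∈binom , ∈[↦]⁺ i∈G (λ { refl → x∉G′ i∈G′ }) , j∉G[x↦y] ,
  trans (∣p[x↦y]∩X∣≡∣p∩X∣ G T x∈G y∉G x≈y) ∣G∩T∣≡s
  where
  j∉G[x↦y] : j ∉ G [ x ↦ y ]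
  j∉G[x↦y] j∈ with ∈[↦]⁻ G j∈
  ... | inj₁ (j∈G , _) = j∉G j∈G
  ... | inj₂ refl      = j∉G′ y∈G′

critical-exchange : ∀ {i j : Fin N} {T s u v G G′ d} → Critical i j T s u v G → Critical i j T s u v G′ →
                    ∣ G ∩ ∁ G′ ∣ ≡ suc d → ∃[ x ] ∃[ y ] Critical i j T s u v (G [ x ↦ y ]) × ∣ G [ x ↦ y ] ∩ ∁ G′ ∣ ≡ d
critical-exchange {T = T} {G = G} {G′ = G′} G-critical@((_ , ∣G∣≡v) , _ , _ , ∣G∩T∣≡s)
                  G′-critical@((_ , ∣G′∣≡v) , _ , _ , ∣G′∩T∣≡s) ∣G∩∁G′∣≡1+d =
  let x , x∈G∩∁G′ = 0<∣p∣⇒Nonempty (subst (0 ℕ.<_) (sym ∣G∩∁G′∣≡1+d) ℕ.z<s)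
      x∈G , x∈∁G′ = x∈p∩q⁻ G (∁ G′) x∈G∩∁G′
      y , y∈G′ , y∉G , x≈y = same-side-partner G G′ T (trans ∣G∣≡v (sym ∣G′∣≡v)) (trans ∣G∩T∣≡s (sym ∣G′∩T∣≡s))
                               x∈G (x∈∁p⇒x∉p x∈∁G′)
      y∉∁G′ = λ y∈∁G′ → x∈∁p⇒x∉p y∈∁G′ y∈G′
  in  x , y , Critical-[↦] G-critical G′-critical x∈G (x∈∁p⇒x∉p x∈∁G′) y∈G′ y∉G x≈y
    , suc-injective (trans (+-comm 1 _) (trans (∣p[x↦y]∩X∣+1≡∣p∩X∣ G (∁ G′) x∈G y∉G x∈∁G′ y∉∁G′) ∣G∩∁G′∣≡1+d))

-- Families whose shift is a Hilton-type family

module ShiftedHilton {N : ℕ} (i j : Fin N) (i<j : i < j) (T : Subset N) (s u v : ℕ) (𝓕 : Family N)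
  (𝓕⊆binom : ∀ A → A ∈F 𝓕 → InBinom u v A)
  (S𝓕≡𝓗 : ∀ A → (A ∈Shift[ i , j ] 𝓕) ⇔ InHilton u v T s A) where

  open Shifting i j 𝓕
  open Equivalence using (to; from)

  i≢j : i ≢ j
  i≢j = <⇒≢ i<j

  𝓗 : Subset N → Set
  𝓗 = InHilton u v T s

  𝓗⇒[j↦i]∈𝓕 : ∀ G → 𝓗 G → j ∈ G → i ∉ G → G [ j ↦ i ] ∈F 𝓕
  𝓗⇒[j↦i]∈𝓕 G G∈𝓗 j∈G i∉G with ∈Shift⇒ G (from (S𝓕≡𝓗 G) G∈𝓗)
  ... | inj₁ (_ , stays)  = stays j∈G i∉G
  ... | inj₂ (i∈G , _)   = contradiction i∈G i∉G

  missing⇒critical : ∀ G → 𝓗 G → G ∉F 𝓕 → Critical i j T s u v G × G [ i ↦ j ] ∈F 𝓕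
  missing⇒critical G G∈𝓗 G∉𝓕 with ∈Shift⇒ G (from (S𝓕≡𝓗 G) G∈𝓗)
  ... | inj₁ (G∈𝓕 , _)              = ⊥-elim (not-¬ G∈𝓕 G∉𝓕)
  ... | inj₂ (i∈G , j∉G , _ , E∈𝓕) = (proj₁ G∈𝓗 , i∈G , j∉G , ≤-antisym ∣G∩T∣≤s (proj₂ G∈𝓗)) , E∈𝓕
    where
    E : Subset N
    E = G [ i ↦ j ]
    E[j↦i]≡G : E [ j ↦ i ] ≡ G
    E[j↦i]≡G = [↦]-inverse G i∈G j∉G
    ∣E∩T∣<s : ∣ E ∩ T ∣ ℕ.< s
    ∣E∩T∣<s = ≰⇒> λ s≤∣E∩T∣ → not-¬ (subst (_∈F 𝓕) E[j↦i]≡G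
      (𝓗⇒[j↦i]∈𝓕 E (𝓕⊆binom E E∈𝓕 , s≤∣E∩T∣) (y∈p[x↦y] G i j) (x∉p[x↦y] G i≢j))) G∉𝓕
    ∣G∩T∣≤s : ∣ G ∩ T ∣ ≤ s
    ∣G∩T∣≤s = begin
      ∣ G ∩ T ∣            ≡⟨ cong (λ X → ∣ X ∩ T ∣) E[j↦i]≡G ⟨
      ∣ E [ j ↦ i ] ∩ T ∣  ≤⟨ ∣p[x↦y]∩X∣≤∣p∩X∣+1 E T (y∈p[x↦y] G i j) (x∉p[x↦y] G i≢j) ⟩
      ∣ E ∩ T ∣ + 1        ≡⟨ +-comm _ 1 ⟩
      suc ∣ E ∩ T ∣        ≤⟨ ∣E∩T∣<s ⟩
      s                    ∎
      where open ≤-Reasoning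

  missing-critical-meets : ∀ {𝓖 : Family N} {t} → CrossInt t 𝓕 𝓖 → ∀ G B → Critical i j T s u v G → G ∉F 𝓕 →
                           B ∈F 𝓖 → i ∈ B → j ∉ B → t ℕ.< ∣ G ∩ B ∣
  missing-critical-meets {t = t} cross G B G-critical@(_ , i∈G , j∉G , _) G∉𝓕 B∈𝓖 i∈B j∉B = begin
    suc t                    ≡⟨ +-comm 1 t ⟩
    t + 1                    ≤⟨ +-monoˡ-≤ 1 (cross (G [ i ↦ j ]) B G[i↦j]∈𝓕 B∈𝓖) ⟩
    ∣ G [ i ↦ j ] ∩ B ∣ + 1  ≡⟨ ∣p[x↦y]∩X∣+1≡∣p∩X∣ G B i∈G j∉G i∈B j∉B ⟩
    ∣ G ∩ B ∣                ∎
    where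
    open ≤-Reasoning
    G[i↦j]∈𝓕 : G [ i ↦ j ] ∈F 𝓕
    G[i↦j]∈𝓕 = proj₂ (missing⇒critical G (Critical⇒Hilton G-critical) G∉𝓕)

  𝓗-member-unless-critical : ∀ G → 𝓗 G → (Critical i j T s u v G → G [ i ↦ j ] ∈F 𝓕 → G ∈F 𝓕) → G ∈F 𝓕
  𝓗-member-unless-critical G G∈𝓗 critical-case with 𝓕 G in G∈?𝓕
  ... | true  = refl
  ... | false = uncurry critical-case (missing⇒critical G G∈𝓗 G∈?𝓕)

  member⇒𝓗⊎moved : ∀ F → F ∈F 𝓕 → 𝓗 F ⊎ (j ∈ F × i ∉ F × 𝓗 (F [ j ↦ i ]) × F [ j ↦ i ] ∉F 𝓕)
  member⇒𝓗⊎moved F F∈𝓕 with survives-or-moves F F∈𝓕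
  ... | inj₁ F∈S𝓕                        = inj₁ (to (S𝓕≡𝓗 F) F∈S𝓕)
  ... | inj₂ (j∈F , i∉F , F′∉𝓕 , F′∈S𝓕) = inj₂ (j∈F , i∉F , to (S𝓕≡𝓗 _) F′∈S𝓕 , F′∉𝓕)

  𝓕≡𝓗-if-i∈T⇒j∈T : (i ∈ T → j ∈ T) → ∀ A → A ∈F 𝓕 ⇔ 𝓗 A
  𝓕≡𝓗-if-i∈T⇒j∈T i∈T⇒j∈T A = mk⇔ (member⇒𝓗 A) (λ A∈𝓗 → 𝓗-member-unless-critical A A∈𝓗 (critical-case A))
    where
    member⇒𝓗 : ∀ F → F ∈F 𝓕 → 𝓗 F
    member⇒𝓗 F F∈𝓕 with member⇒𝓗⊎moved F F∈𝓕
    ... | inj₁ F∈𝓗                     = F∈𝓗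
    ... | inj₂ (j∈F , i∉F , F′∈𝓗 , _) =
      𝓕⊆binom F F∈𝓕 , ≤-trans (proj₂ F′∈𝓗) (∣p[x↦y]∩X∣≤∣p∩X∣ F T j∈F i∉F i∈T⇒j∈T)
    critical-case : ∀ G → Critical i j T s u v G → G [ i ↦ j ] ∈F 𝓕 → G ∈F 𝓕
    critical-case G (_ , i∈G , j∉G , _) E∈𝓕 = subst (_∈F 𝓕) ([↦]-inverse G i∈G j∉G)
      (𝓗⇒[j↦i]∈𝓕 E (member⇒𝓗 E E∈𝓕) (y∈p[x↦y] G i j) (x∉p[x↦y] G i≢j))
      where E = G [ i ↦ j ]

  𝓕≡𝓗-if-critical∈ : (∀ G → Critical i j T s u v G → G ∈F 𝓕) → ∀ A → A ∈F 𝓕 ⇔ 𝓗 A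
  𝓕≡𝓗-if-critical∈ critical∈𝓕 A =
    mk⇔ member⇒𝓗 (λ A∈𝓗 → 𝓗-member-unless-critical A A∈𝓗 (λ A-critical _ → critical∈𝓕 A A-critical))
    where
    member⇒𝓗 : A ∈F 𝓕 → 𝓗 A
    member⇒𝓗 A∈𝓕 with member⇒𝓗⊎moved A A∈𝓕
    ... | inj₁ A∈𝓗                  = A∈𝓗
    ... | inj₂ (_ , _ , G∈𝓗 , G∉𝓕) =
      ⊥-elim (not-¬ (critical∈𝓕 _ (proj₁ (missing⇒critical _ G∈𝓗 G∉𝓕))) G∉𝓕)

  𝓕≡𝓗[i↦j]-if-critical∉ : i ∈ T → j ∉ T → (∀ G → Critical i j T s u v G → G ∉F 𝓕) →
                          ∀ A → A ∈F 𝓕 ⇔ InHilton u v (T [ i ↦ j ]) s A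
  𝓕≡𝓗[i↦j]-if-critical∉ i∈T j∉T critical∉𝓕 A = mk⇔ (member⇒𝓗′ A) (𝓗′⇒member A)
    where
    T′ : Subset N
    T′ = T [ i ↦ j ]
    j∈T′ : j ∈ T′
    j∈T′ = y∈p[x↦y] T i j
    i∉T′ : i ∉ T′
    i∉T′ = x∉p[x↦y] T i≢j

    ∣F∩T∣≤∣F∩T′∣ : ∀ F → (i ∈ F → j ∈ F) → ∣ F ∩ T ∣ ≤ ∣ F ∩ T′ ∣
    ∣F∩T∣≤∣F∩T′∣ F i∈F⇒j∈F = begin
      ∣ F ∩ T ∣              ≡⟨ ∣p∩q∣≡∣q∩p∣ F T ⟩
      ∣ T ∩ F ∣              ≡⟨ cong (λ X → ∣ X ∩ F ∣) ([↦]-inverse T i∈T j∉T) ⟨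
      ∣ T′ [ j ↦ i ] ∩ F ∣   ≤⟨ ∣p[x↦y]∩X∣≤∣p∩X∣ T′ F j∈T′ i∉T′ i∈F⇒j∈F ⟩
      ∣ T′ ∩ F ∣             ≡⟨ ∣p∩q∣≡∣q∩p∣ T′ F ⟩
      ∣ F ∩ T′ ∣             ∎
      where open ≤-Reasoning

    ∣F∩T′∣≤∣F∩T∣ : ∀ F → (j ∈ F → i ∈ F) → ∣ F ∩ T′ ∣ ≤ ∣ F ∩ T ∣
    ∣F∩T′∣≤∣F∩T∣ F j∈F⇒i∈F = begin
      ∣ F ∩ T′ ∣  ≡⟨ ∣p∩q∣≡∣q∩p∣ F T′ ⟩
      ∣ T′ ∩ F ∣  ≤⟨ ∣p[x↦y]∩X∣≤∣p∩X∣ T F i∈T j∉T j∈F⇒i∈F ⟩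
      ∣ T ∩ F ∣   ≡⟨ ∣p∩q∣≡∣q∩p∣ T F ⟩
      ∣ F ∩ T ∣   ∎
      where open ≤-Reasoning

    ∣F∩T′∣≡∣F[j↦i]∩T∣ : ∀ F → j ∈ F → i ∉ F → ∣ F ∩ T′ ∣ ≡ ∣ F [ j ↦ i ] ∩ T ∣
    ∣F∩T′∣≡∣F[j↦i]∩T∣ F j∈F i∉F = begin
      ∣ F ∩ T′ ∣             ≡⟨ ∣p∩q∣≡∣q∩p∣ F T′ ⟩
      ∣ T′ ∩ F ∣             ≡⟨ ∣p[x↦y]∩X∣≡∣p∩X∣+1 T F i∈T j∉T i∉F j∈F ⟩
      ∣ T ∩ F ∣ + 1          ≡⟨ cong (_+ 1) (∣p∩q∣≡∣q∩p∣ T F) ⟩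
      ∣ F ∩ T ∣ + 1          ≡⟨ ∣p[x↦y]∩X∣≡∣p∩X∣+1 F T j∈F i∉F j∉T i∈T ⟨
      ∣ F [ j ↦ i ] ∩ T ∣    ∎
      where open ≡-Reasoning

    ∣F∩T′∣+1≡∣F∩T∣ : ∀ F → i ∈ F → j ∉ F → ∣ F ∩ T′ ∣ + 1 ≡ ∣ F ∩ T ∣
    ∣F∩T′∣+1≡∣F∩T∣ F i∈F j∉F = begin
      ∣ F ∩ T′ ∣ + 1  ≡⟨ cong (_+ 1) (∣p∩q∣≡∣q∩p∣ F T′) ⟩
      ∣ T′ ∩ F ∣ + 1  ≡⟨ ∣p[x↦y]∩X∣+1≡∣p∩X∣ T F i∈T j∉T i∈F j∉F ⟩
      ∣ T ∩ F ∣       ≡⟨ ∣p∩q∣≡∣q∩p∣ T F ⟩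
      ∣ F ∩ T ∣       ∎
      where open ≡-Reasoning

    member⇒𝓗′ : ∀ F → F ∈F 𝓕 → InHilton u v T′ s F
    member⇒𝓗′ F F∈𝓕 with member⇒𝓗⊎moved F F∈𝓕
    ... | inj₂ (j∈F , i∉F , F′∈𝓗 , _) =
      𝓕⊆binom F F∈𝓕 , ≤-trans (proj₂ F′∈𝓗) (≤-reflexive (sym (∣F∩T′∣≡∣F[j↦i]∩T∣ F j∈F i∉F)))
    ... | inj₁ F∈𝓗 with i ∈? F | j ∈? F
    ...   | yes i∈F | no j∉F  = 𝓕⊆binom F F∈𝓕 , +-cancelʳ-≤ 1 s _ (begin
            s + 1          ≡⟨ +-comm s 1 ⟩
            suc s          ≤⟨ ≤∧≢⇒< (proj₂ F∈𝓗) F-not-critical ⟩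
            ∣ F ∩ T ∣      ≡⟨ ∣F∩T′∣+1≡∣F∩T∣ F i∈F j∉F ⟨
            ∣ F ∩ T′ ∣ + 1 ∎)
      where
      open ≤-Reasoning
      F-not-critical : s ≢ ∣ F ∩ T ∣
      F-not-critical s≡ = not-¬ F∈𝓕 (critical∉𝓕 F (𝓕⊆binom F F∈𝓕 , i∈F , j∉F , sym s≡))
    ...   | no  i∉F | _       = 𝓕⊆binom F F∈𝓕 , ≤-trans (proj₂ F∈𝓗) (∣F∩T∣≤∣F∩T′∣ F (λ i∈F → contradiction i∈F i∉F))
    ...   | yes _   | yes j∈F = 𝓕⊆binom F F∈𝓕 , ≤-trans (proj₂ F∈𝓗) (∣F∩T∣≤∣F∩T′∣ F (const j∈F))

    𝓗′⇒member : ∀ A → InHilton u v T′ s A → A ∈F 𝓕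
    𝓗′⇒member A (A∈binom , s≤∣A∩T′∣) with s ≤? ∣ A ∩ T ∣
    ... | yes s≤∣A∩T∣ = 𝓗-member-unless-critical A (A∈binom , s≤∣A∩T∣) λ (_ , i∈A , j∉A , ∣A∩T∣≡s) _ →
      ⊥-elim (n≮n s (begin-strict
        s               ≤⟨ s≤∣A∩T′∣ ⟩
        ∣ A ∩ T′ ∣      <⟨ m<m+n _ ℕ.z<s ⟩
        ∣ A ∩ T′ ∣ + 1  ≡⟨ ∣F∩T′∣+1≡∣F∩T∣ A i∈A j∉A ⟩
        ∣ A ∩ T ∣       ≡⟨ ∣A∩T∣≡s ⟩
        s               ∎))
      where open ≤-Reasoning
    ... | no s≰∣A∩T∣ with j ∈? A | i ∈? A
    ...   | yes j∈A | no i∉A  = subst (_∈F 𝓕) ([↦]-inverse A j∈A i∉A)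
            (proj₂ (missing⇒critical E (Critical⇒Hilton E-critical) (critical∉𝓕 E E-critical)))
      where
      E : Subset N
      E = A [ j ↦ i ]
      ∣E∩T∣≡∣A∩T∣+1 : ∣ E ∩ T ∣ ≡ ∣ A ∩ T ∣ + 1
      ∣E∩T∣≡∣A∩T∣+1 = ∣p[x↦y]∩X∣≡∣p∩X∣+1 A T j∈A i∉A j∉T i∈T
      E-critical : Critical i j T s u v E
      E-critical = InBinom-[↦] A j∈A i∉A (<-trans i<j (proj₁ A∈binom j j∈A)) A∈binom
                 , y∈p[x↦y] A j i , x∉p[x↦y] A (i≢j ∘ sym)
                 , ≤-antisym (subst (_≤ s) (trans (+-comm 1 _) (sym ∣E∩T∣≡∣A∩T∣+1)) (≰⇒> s≰∣A∩T∣))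
                             (≤-trans s≤∣A∩T′∣ (≤-reflexive (∣F∩T′∣≡∣F[j↦i]∩T∣ A j∈A i∉A)))
    ...   | no  j∉A | _       = ⊥-elim (s≰∣A∩T∣ (≤-trans s≤∣A∩T′∣ (∣F∩T′∣≤∣F∩T∣ A (λ j∈A → contradiction j∈A j∉A))))
    ...   | yes _   | yes i∈A = ⊥-elim (s≰∣A∩T∣ (≤-trans s≤∣A∩T′∣ (∣F∩T′∣≤∣F∩T∣ A (const i∈A))))

-- Constructing critical sets

module CriticalConstruction {N : ℕ} (i j : Fin N) (T : Subset N) (t r : ℕ)
  (i∈T : i ∈ T) (j∉T : j ∉ T) (∣T∣≡t+2r : ∣ T ∣ ≡ t + 2 * r) where

  s : ℕ
  s = t + r

  -- Y is W together with e points of [u] outside T ∪ E ∪ {j}.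
  extend-to-critical : ∀ {u} e (W E : Subset N) → u ≤ N → T ⊆ below u → W ⊆ T → i ∈ W → ∣ W ∣ ≡ s →
        e + ∣ T ∪ E ∣ + 1 ≤ u → ∃[ Y ] Critical i j T s u (s + e) Y × Y ∩ E ⊆ W
  extend-to-critical {u} e W E u≤N T⊆[u] W⊆T i∈W ∣W∣≡s room =
    Y , (Y∈binom , W⊆Y i∈W , j∉Y , ∣Y∩T∣≡s) , Y∩E⊆W
    where
    Z R : Subset N
    Z = (T ∪ E) ∪ ⁅ j ⁆
    R = below {N} u ∩ ∁ Z

    z∈R⇒z∉Z : z ∈ R → z ∉ Z
    z∈R⇒z∉Z z∈R = x∈∁p⇒x∉p (proj₂ (x∈p∩q⁻ _ _ z∈R))

    z∈R⇒z∉T : z ∈ R → z ∉ T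
    z∈R⇒z∉T z∈R z∈T = z∈R⇒z∉Z z∈R (x∈p∪q⁺ (inj₁ (x∈p∪q⁺ (inj₁ z∈T))))

    e≤∣R∣ : e ≤ ∣ R ∣
    e≤∣R∣ = +-cancelʳ-≤ (∣ T ∪ E ∣ + 1) e ∣ R ∣ (begin
      e + (∣ T ∪ E ∣ + 1)          ≡⟨ +-assoc e _ 1 ⟨
      e + ∣ T ∪ E ∣ + 1            ≤⟨ room ⟩
      u                            ≡⟨ ∣below∣ u≤N ⟨
      ∣ below {N} u ∣              ≡⟨ ∣p∩q∣+∣p∩∁q∣≡∣p∣ (below {N} u) Z ⟨
      ∣ below {N} u ∩ Z ∣ + ∣ R ∣  ≤⟨ +-monoˡ-≤ ∣ R ∣ (∣p∩q∣≤∣q∣ (below {N} u) Z) ⟩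
      ∣ Z ∣ + ∣ R ∣                ≤⟨ +-monoˡ-≤ ∣ R ∣ (∣p∪q∣≤∣p∣+∣q∣ (T ∪ E) ⁅ j ⁆) ⟩
      ∣ T ∪ E ∣ + ∣ ⁅ j ⁆ ∣ + ∣ R ∣  ≡⟨ cong (λ a → ∣ T ∪ E ∣ + a + ∣ R ∣) (∣⁅x⁆∣≡1 j) ⟩
      ∣ T ∪ E ∣ + 1 + ∣ R ∣        ≡⟨ +-comm _ ∣ R ∣ ⟩
      ∣ R ∣ + (∣ T ∪ E ∣ + 1)      ∎)
      where open ≤-Reasoning

    ∣W∪R∣≡s+∣R∣ : ∣ W ∪ R ∣ ≡ s + ∣ R ∣
    ∣W∪R∣≡s+∣R∣ = trans (∣p∪q∣≡∣p∣+∣q∣ W R disjoint) (cong (_+ ∣ R ∣) ∣W∣≡s)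
      where
      disjoint : Empty (W ∩ R)
      disjoint (z , z∈W∩R) = let z∈W , z∈R = x∈p∩q⁻ W R z∈W∩R in z∈R⇒z∉T z∈R (W⊆T z∈W)

    chosen : ∃[ Y ] W ⊆ Y × Y ⊆ W ∪ R × ∣ Y ∣ ≡ s + e
    chosen = subset-between W (W ∪ R) (s + e) (p⊆p∪q R) (≤-trans (≤-reflexive ∣W∣≡s) (m≤m+n s e))
               (≤-trans (+-monoʳ-≤ s e≤∣R∣) (≤-reflexive (sym ∣W∪R∣≡s+∣R∣)))
    Y : Subset N
    Y = proj₁ chosen
    W⊆Y : W ⊆ Y
    W⊆Y = proj₁ (proj₂ chosen)

    Y⊆W⊎R : z ∈ Y → z ∈ W ⊎ z ∈ R
    Y⊆W⊎R z∈Y = x∈p∪q⁻ W R (proj₁ (proj₂ (proj₂ chosen)) z∈Y)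

    Y∈binom : InBinom u (s + e) Y
    Y∈binom = range , proj₂ (proj₂ (proj₂ chosen))
      where
      range : InRange u Y
      range z z∈Y with Y⊆W⊎R z∈Y
      ... | inj₁ z∈W = ∈below⁻ (T⊆[u] (W⊆T z∈W))
      ... | inj₂ z∈R = ∈below⁻ (proj₁ (x∈p∩q⁻ _ _ z∈R))

    j∉Y : j ∉ Y
    j∉Y j∈Y with Y⊆W⊎R j∈Y
    ... | inj₁ j∈W = j∉T (W⊆T j∈W)
    ... | inj₂ j∈R = z∈R⇒z∉Z j∈R (x∈p∪q⁺ (inj₂ (x∈⁅x⁆ j)))

    Y∩E⊆W : Y ∩ E ⊆ W
    Y∩E⊆W z∈Y∩E with x∈p∩q⁻ Y E z∈Y∩E
    ... | z∈Y , z∈E with Y⊆W⊎R z∈Y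
    ...   | inj₁ z∈W = z∈W
    ...   | inj₂ z∈R = contradiction (x∈p∪q⁺ (inj₁ (x∈p∪q⁺ (inj₂ z∈E)))) (z∈R⇒z∉Z z∈R)

    ∣Y∩T∣≡s : ∣ Y ∩ T ∣ ≡ s
    ∣Y∩T∣≡s = ≤-antisym (≤-trans (p⊆q⇒∣p∣≤∣q∣ Y∩T⊆W) (≤-reflexive ∣W∣≡s))
                        (≤-trans (≤-reflexive (sym ∣W∣≡s)) (p⊆q⇒∣p∣≤∣q∣ W⊆Y∩T))
      where
      Y∩T⊆W : Y ∩ T ⊆ W
      Y∩T⊆W z∈Y∩T with x∈p∩q⁻ Y T z∈Y∩T
      ... | z∈Y , z∈T with Y⊆W⊎R z∈Y
      ...   | inj₁ z∈W = z∈W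
      ...   | inj₂ z∈R = contradiction z∈T (z∈R⇒z∉T z∈R)
      W⊆Y∩T : W ⊆ Y ∩ T
      W⊆Y∩T z∈W = x∈p∩q⁺ (W⊆Y z∈W , W⊆T z∈W)

  s+r≡∣T∣ : s + r ≡ ∣ T ∣
  s+r≡∣T∣ = begin
    t + r + r        ≡⟨ +-assoc t r r ⟩
    t + (r + r)      ≡⟨ cong (λ a → t + (r + a)) (+-identityʳ r) ⟨
    t + 2 * r        ≡⟨ ∣T∣≡t+2r ⟨
    ∣ T ∣            ∎
    where open ≡-Reasoning

  s+s≡t+∣T∣ : s + s ≡ t + ∣ T ∣
  s+s≡t+∣T∣ = begin
    t + r + (t + r)  ≡⟨ +-assoc t r s ⟩
    t + (r + s)      ≡⟨ cong (t +_) (trans (+-comm r s) s+r≡∣T∣) ⟩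
    t + ∣ T ∣        ∎
    where open ≡-Reasoning

  ∣W∩X∣≤t : ∀ (W X : Subset N) → W ⊆ T → T ⊆ W ∪ X → ∣ W ∣ ≡ s → ∣ X ∩ T ∣ ≤ s → ∣ W ∩ X ∣ ≤ t
  ∣W∩X∣≤t W X W⊆T T⊆W∪X ∣W∣≡s ∣X∩T∣≤s = +-cancelʳ-≤ ∣ T ∣ _ _ (begin
    ∣ W ∩ X ∣ + ∣ T ∣    ≤⟨ ∣p∩q∣+∣r∣≤∣p∣+∣q∩r∣ W X T W⊆T T⊆W∪X ⟩
    ∣ W ∣ + ∣ X ∩ T ∣    ≤⟨ +-mono-≤ (≤-reflexive ∣W∣≡s) ∣X∩T∣≤s ⟩
    s + s                ≡⟨ s+s≡t+∣T∣ ⟩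
    t + ∣ T ∣            ∎)
    where open ≤-Reasoning

  -- W ⊆ T contains i and T ∖ (P ∩ Q), so |W ∩ P| = |W| + |P ∩ T| − |T| ≤ t, and likewise for Q.
  common-critical-neighbour : ∀ {u} e (P Q : Subset N) → u ≤ N → T ⊆ below u →
              ∣ P ∩ T ∣ ≤ s → ∣ Q ∩ T ∣ ≤ s → r + 1 ≤ ∣ (P ∩ Q) ∩ T ∣ → e + ∣ T ∪ (P ∪ Q) ∣ + 1 ≤ u →
              ∃[ Y ] Critical i j T s u (s + e) Y × ∣ Y ∩ P ∣ ≤ t × ∣ Y ∩ Q ∣ ≤ t
  common-critical-neighbour e P Q u≤N T⊆[u] ∣P∩T∣≤s ∣Q∩T∣≤s r<∣P∩Q∩T∣ room =
    let Y , Y-critical , Y∩[P∪Q]⊆W = extend-to-critical e W (P ∪ Q) u≤N T⊆[u] W⊆T (h⊆W i∈h) ∣W∣≡s room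
    in  Y , Y-critical , ∣Y∩X∣≤t Y P Y∩[P∪Q]⊆W (p⊆p∪q Q) (p∩q⊆p P Q) ∣P∩T∣≤s
                       , ∣Y∩X∣≤t Y Q Y∩[P∪Q]⊆W (q⊆p∪q P Q) (p∩q⊆q P Q) ∣Q∩T∣≤s
    where
    h : Subset N
    h = ⁅ i ⁆ ∪ (T ∩ ∁ (P ∩ Q))

    i∈h : i ∈ h
    i∈h = x∈p∪q⁺ (inj₁ (x∈⁅x⁆ i))

    h⊆T : h ⊆ T
    h⊆T z∈h with x∈p∪q⁻ _ _ z∈h
    ... | inj₁ z∈⁅i⁆ = subst (_∈ T) (sym (x∈⁅y⁆⇒x≡y i z∈⁅i⁆)) i∈T
    ... | inj₂ z∈T∩… = proj₁ (x∈p∩q⁻ _ _ z∈T∩…)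

    ∣h∣≤s : ∣ h ∣ ≤ s
    ∣h∣≤s = +-cancelʳ-≤ r _ _ (begin
      ∣ h ∣ + r                                      ≤⟨ +-monoˡ-≤ r (∣p∪q∣≤∣p∣+∣q∣ ⁅ i ⁆ _) ⟩
      ∣ ⁅ i ⁆ ∣ + ∣ T ∩ ∁ (P ∩ Q) ∣ + r              ≡⟨ cong (λ a → a + ∣ T ∩ ∁ (P ∩ Q) ∣ + r) (∣⁅x⁆∣≡1 i) ⟩
      1 + ∣ T ∩ ∁ (P ∩ Q) ∣ + r                      ≡⟨ +-comm (1 + _) r ⟩
      r + (1 + ∣ T ∩ ∁ (P ∩ Q) ∣)                    ≡⟨ +-assoc r 1 _ ⟨
      r + 1 + ∣ T ∩ ∁ (P ∩ Q) ∣                      ≤⟨ +-monoˡ-≤ _ r<∣P∩Q∩T∣ ⟩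
      ∣ (P ∩ Q) ∩ T ∣ + ∣ T ∩ ∁ (P ∩ Q) ∣            ≡⟨ cong (_+ ∣ T ∩ ∁ (P ∩ Q) ∣) (∣p∩q∣≡∣q∩p∣ (P ∩ Q) T) ⟩
      ∣ T ∩ (P ∩ Q) ∣ + ∣ T ∩ ∁ (P ∩ Q) ∣            ≡⟨ ∣p∩q∣+∣p∩∁q∣≡∣p∣ T (P ∩ Q) ⟩
      ∣ T ∣                                          ≡⟨ s+r≡∣T∣ ⟨
      s + r                                          ∎)
      where open ≤-Reasoning

    chosen : ∃[ W ] h ⊆ W × W ⊆ T × ∣ W ∣ ≡ s
    chosen = subset-between h T s h⊆T ∣h∣≤s (≤-trans (m≤m+n s r) (≤-reflexive s+r≡∣T∣))
    W : Subset N
    W = proj₁ chosen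
    h⊆W : h ⊆ W
    h⊆W = proj₁ (proj₂ chosen)
    W⊆T : W ⊆ T
    W⊆T = proj₁ (proj₂ (proj₂ chosen))
    ∣W∣≡s : ∣ W ∣ ≡ s
    ∣W∣≡s = proj₂ (proj₂ (proj₂ chosen))

    T⊆W∪X : ∀ X → P ∩ Q ⊆ X → T ⊆ W ∪ X
    T⊆W∪X X P∩Q⊆X {z} z∈T with z ∈? P ∩ Q
    ... | yes z∈P∩Q = x∈p∪q⁺ (inj₂ (P∩Q⊆X z∈P∩Q))
    ... | no  z∉P∩Q = x∈p∪q⁺ (inj₁ (h⊆W (x∈p∪q⁺ (inj₂ (x∈p∩q⁺ (z∈T , x∉p⇒x∈∁p z∉P∩Q))))))

    ∣Y∩X∣≤t : ∀ Y X → Y ∩ (P ∪ Q) ⊆ W → X ⊆ P ∪ Q → P ∩ Q ⊆ X → ∣ X ∩ T ∣ ≤ s → ∣ Y ∩ X ∣ ≤ t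
    ∣Y∩X∣≤t Y X Y∩[P∪Q]⊆W X⊆P∪Q P∩Q⊆X ∣X∩T∣≤s =
      ≤-trans (p⊆q⇒∣p∣≤∣q∣ Y∩X⊆W∩X) (∣W∩X∣≤t W X W⊆T (T⊆W∪X X P∩Q⊆X) ∣W∣≡s ∣X∩T∣≤s)
      where
      Y∩X⊆W∩X : Y ∩ X ⊆ W ∩ X
      Y∩X⊆W∩X z∈Y∩X = let z∈Y , z∈X = x∈p∩q⁻ Y X z∈Y∩X in
        x∈p∩q⁺ (Y∩[P∪Q]⊆W (x∈p∩q⁺ (z∈Y , X⊆P∪Q z∈X)) , z∈X)

-- Pairs of cross-intersecting families

module HiltonPair {N : ℕ} (i j : Fin N) (i<j : i < j) (T : Subset N) (t r k′ l′ m n : ℕ)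
  (2≤t : 2 ≤ t) (m≤N : m ≤ N) (n≤N : n ≤ N)
  (∣T∣≡t+2r : ∣ T ∣ ≡ t + 2 * r) (T⊆[m⊓n] : InRange (m ⊓ n) T) (i∈T : i ∈ T) (j∉T : j ∉ T)
  (room : ∣ T ∣ + k′ + l′ + 2 ≤ m ⊓ n)
  (𝓐 𝓑 : Family N)
  (𝓐⊆binom : ∀ A → A ∈F 𝓐 → InBinom n (t + r + k′) A)
  (𝓑⊆binom : ∀ B → B ∈F 𝓑 → InBinom m (t + r + l′) B)
  (cross : CrossInt t 𝓐 𝓑)
  (S𝓐≡𝓗 : ∀ A → (A ∈Shift[ i , j ] 𝓐) ⇔ InHilton n (t + r + k′) T (t + r) A)
  (S𝓑≡𝓗 : ∀ B → (B ∈Shift[ i , j ] 𝓑) ⇔ InHilton m (t + r + l′) T (t + r) B) where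

  open CriticalConstruction i j T t r i∈T j∉T ∣T∣≡t+2r
  module Shifted𝓐 = ShiftedHilton i j i<j T s n (s + k′) 𝓐 𝓐⊆binom S𝓐≡𝓗
  module Shifted𝓑 = ShiftedHilton i j i<j T s m (s + l′) 𝓑 𝓑⊆binom S𝓑≡𝓗

  Critical𝓐 Critical𝓑 : Subset N → Set
  Critical𝓐 = Critical i j T s n (s + k′)
  Critical𝓑 = Critical i j T s m (s + l′)

  T⊆[m] : T ⊆ below m
  T⊆[m] x∈T = ∈below⁺ (<-≤-trans (T⊆[m⊓n] _ x∈T) (m⊓n≤m m n))

  T⊆[n] : T ⊆ below n
  T⊆[n] x∈T = ∈below⁺ (<-≤-trans (T⊆[m⊓n] _ x∈T) (m⊓n≤n m n))

  room𝓐 : ∀ X → ∣ T ∪ X ∣ ≤ ∣ T ∣ + l′ → k′ + ∣ T ∪ X ∣ + 1 ≤ n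
  room𝓐 X ∣T∪X∣≤ = begin
    k′ + ∣ T ∪ X ∣ + 1            ≤⟨ +-monoˡ-≤ 1 (+-monoʳ-≤ k′ ∣T∪X∣≤) ⟩
    k′ + (∣ T ∣ + l′) + 1         ≡⟨ lemma ∣ T ∣ k′ l′ ⟩
    ∣ T ∣ + k′ + l′ + 1           ≤⟨ +-monoʳ-≤ (∣ T ∣ + k′ + l′) (s≤s z≤n) ⟩
    ∣ T ∣ + k′ + l′ + 2           ≤⟨ room ⟩
    m ⊓ n                         ≤⟨ m⊓n≤n m n ⟩
    n                             ∎
    where
    open ≤-Reasoning
    lemma : ∀ a k l → k + (a + l) + 1 ≡ a + k + l + 1
    lemma = solve-∀

  room𝓑 : ∀ X → ∣ T ∪ X ∣ ≤ ∣ T ∣ + k′ + 1 → l′ + ∣ T ∪ X ∣ + 1 ≤ m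
  room𝓑 X ∣T∪X∣≤ = begin
    l′ + ∣ T ∪ X ∣ + 1            ≤⟨ +-monoˡ-≤ 1 (+-monoʳ-≤ l′ ∣T∪X∣≤) ⟩
    l′ + (∣ T ∣ + k′ + 1) + 1     ≡⟨ lemma ∣ T ∣ k′ l′ ⟩
    ∣ T ∣ + k′ + l′ + 2           ≤⟨ room ⟩
    m ⊓ n                         ≤⟨ m⊓n≤m m n ⟩
    m                             ∎
    where
    open ≤-Reasoning
    lemma : ∀ a k l → l + (a + k + 1) + 1 ≡ a + k + l + 2
    lemma = solve-∀

  close⇒same-status : ∀ G B → Critical𝓐 G → Critical𝓑 B → ∣ G ∩ B ∣ ≤ t → 𝓐 G ≡ 𝓑 B
  close⇒same-status G B G-critical@(_ , i∈G , j∉G , _) B-critical@(_ , i∈B , j∉B , _) ∣G∩B∣≤t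
    with 𝓐 G in G∈?𝓐 | 𝓑 B in B∈?𝓑
  ... | true  | true  = refl
  ... | false | false = refl
  ... | false | true  = contradiction (Shifted𝓐.missing-critical-meets cross G B G-critical G∈?𝓐 B∈?𝓑 i∈B j∉B)
                                      (≤⇒≯ ∣G∩B∣≤t)
  ... | true  | false = contradiction (Shifted𝓑.missing-critical-meets cross′ B G B-critical B∈?𝓑 G∈?𝓐 i∈G j∉G)
                                      (≤⇒≯ (subst (_≤ t) (∣p∩q∣≡∣q∩p∣ G B) ∣G∩B∣≤t))
    where
    cross′ : CrossInt t 𝓑 𝓐
    cross′ B A B∈𝓑 A∈𝓐 = subst (t ≤_) (∣p∩q∣≡∣q∩p∣ A B) (cross A B A∈𝓐 B∈𝓑)

  critical𝓐-neighbour : ∀ B → Critical𝓑 B → ∃[ G ] Critical𝓐 G × ∣ G ∩ B ∣ ≤ t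
  critical𝓐-neighbour B ((_ , ∣B∣≡s+l′) , _ , _ , ∣B∩T∣≡s) =
    let G , G-critical , ∣G∩B∣≤t , _ = common-critical-neighbour k′ B B n≤N T⊆[n]
                                         (≤-reflexive ∣B∩T∣≡s) (≤-reflexive ∣B∩T∣≡s) r+1≤∣[B∩B]∩T∣
                                         (room𝓐 (B ∪ B) ∣T∪[B∪B]∣≤∣T∣+l′)
    in  G , G-critical , ∣G∩B∣≤t
    where
    r+1≤∣[B∩B]∩T∣ : r + 1 ≤ ∣ (B ∩ B) ∩ T ∣
    r+1≤∣[B∩B]∩T∣ = begin
      r + 1            ≡⟨ +-comm r 1 ⟩
      1 + r            ≤⟨ +-monoˡ-≤ r (≤-trans (s≤s z≤n) 2≤t) ⟩
      t + r            ≡⟨ ∣B∩T∣≡s ⟨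
      ∣ B ∩ T ∣        ≡⟨ cong (λ X → ∣ X ∩ T ∣) (∩-idem B) ⟨
      ∣ (B ∩ B) ∩ T ∣  ∎
      where open ≤-Reasoning
    ∣T∪[B∪B]∣≤∣T∣+l′ : ∣ T ∪ (B ∪ B) ∣ ≤ ∣ T ∣ + l′
    ∣T∪[B∪B]∣≤∣T∣+l′ = ≤-reflexive (trans (cong (λ X → ∣ T ∪ X ∣) (∪-idem B)) (∣p∪q∣≡∣p∣+e T B ∣B∩T∣≡s ∣B∣≡s+l′))

  exchange-preserves-status : ∀ G x y → Critical𝓐 G → Critical𝓐 (G [ x ↦ y ]) → 𝓐 G ≡ 𝓐 (G [ x ↦ y ])
  exchange-preserves-status G x y G-critical@((_ , ∣G∣≡s+k′) , _ , _ , ∣G∩T∣≡s)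
                               G′-critical@(_ , _ , _ , ∣G′∩T∣≡s) =
    let B , B-critical , ∣B∩G∣≤t , ∣B∩G′∣≤t = common-critical-neighbour l′ G G′ m≤N T⊆[m]
                                                (≤-reflexive ∣G∩T∣≡s) (≤-reflexive ∣G′∩T∣≡s) r+1≤∣[G∩G′]∩T∣
                                                (room𝓑 (G ∪ G′) ∣T∪[G∪G′]∣≤∣T∣+k′+1)
    in  trans (close⇒same-status G B G-critical B-critical (subst (_≤ t) (∣p∩q∣≡∣q∩p∣ B G) ∣B∩G∣≤t))
              (sym (close⇒same-status G′ B G′-critical B-critical (subst (_≤ t) (∣p∩q∣≡∣q∩p∣ B G′) ∣B∩G′∣≤t)))
    where
    G′ : Subset N
    G′ = G [ x ↦ y ]

    [G-x]∩T⊆[G∩G′]∩T : (G - x) ∩ T ⊆ (G ∩ G′) ∩ T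
    [G-x]∩T⊆[G∩G′]∩T z∈ =
      let z∈G-x , z∈T = x∈p∩q⁻ (G - x) T z∈
          z∈G , z≢x = x∈p-y⇒x∈p∧x≢y G z∈G-x
      in  x∈p∩q⁺ (x∈p∩q⁺ (z∈G , ∈[↦]⁺ z∈G z≢x) , z∈T)

    r+1≤∣[G∩G′]∩T∣ : r + 1 ≤ ∣ (G ∩ G′) ∩ T ∣
    r+1≤∣[G∩G′]∩T∣ = +-cancelʳ-≤ 1 _ _ (begin
      r + 1 + 1               ≡⟨ +-comm (r + 1) 1 ⟩
      suc (r + 1)             ≡⟨ cong suc (+-comm r 1) ⟩
      2 + r                   ≤⟨ +-monoˡ-≤ r 2≤t ⟩
      t + r                   ≡⟨ ∣G∩T∣≡s ⟨
      ∣ G ∩ T ∣               ≤⟨ ∣p∩X∣≤∣[p-x]∩X∣+1 G T x ⟩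
      ∣ (G - x) ∩ T ∣ + 1     ≤⟨ +-monoˡ-≤ 1 (p⊆q⇒∣p∣≤∣q∣ [G-x]∩T⊆[G∩G′]∩T) ⟩
      ∣ (G ∩ G′) ∩ T ∣ + 1    ∎)
      where open ≤-Reasoning

    T∪[G∪G′]⊆[T∪G]∪⁅y⁆ : T ∪ (G ∪ G′) ⊆ (T ∪ G) ∪ ⁅ y ⁆
    T∪[G∪G′]⊆[T∪G]∪⁅y⁆ z∈ with x∈p∪q⁻ T (G ∪ G′) z∈
    ... | inj₁ z∈T = x∈p∪q⁺ (inj₁ (x∈p∪q⁺ (inj₁ z∈T)))
    ... | inj₂ z∈G∪G′ with x∈p∪q⁻ G G′ z∈G∪G′
    ...   | inj₁ z∈G  = x∈p∪q⁺ (inj₁ (x∈p∪q⁺ (inj₂ z∈G)))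
    ...   | inj₂ z∈G′ with ∈[↦]⁻ G z∈G′
    ...     | inj₁ (z∈G , _) = x∈p∪q⁺ (inj₁ (x∈p∪q⁺ (inj₂ z∈G)))
    ...     | inj₂ refl      = x∈p∪q⁺ (inj₂ (x∈⁅x⁆ y))

    ∣T∪[G∪G′]∣≤∣T∣+k′+1 : ∣ T ∪ (G ∪ G′) ∣ ≤ ∣ T ∣ + k′ + 1
    ∣T∪[G∪G′]∣≤∣T∣+k′+1 = begin
      ∣ T ∪ (G ∪ G′) ∣          ≤⟨ p⊆q⇒∣p∣≤∣q∣ T∪[G∪G′]⊆[T∪G]∪⁅y⁆ ⟩
      ∣ (T ∪ G) ∪ ⁅ y ⁆ ∣       ≤⟨ ∣p∪q∣≤∣p∣+∣q∣ (T ∪ G) ⁅ y ⁆ ⟩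
      ∣ T ∪ G ∣ + ∣ ⁅ y ⁆ ∣     ≡⟨ cong₂ _+_ (∣p∪q∣≡∣p∣+e T G ∣G∩T∣≡s ∣G∣≡s+k′) (∣⁅x⁆∣≡1 y) ⟩
      ∣ T ∣ + k′ + 1            ∎
      where open ≤-Reasoning

  critical𝓐-same-status : ∀ d G G′ → Critical𝓐 G → Critical𝓐 G′ → ∣ G ∩ ∁ G′ ∣ ≡ d → 𝓐 G ≡ 𝓐 G′
  critical𝓐-same-status zero G G′ ((_ , ∣G∣≡v) , _) ((_ , ∣G′∣≡v) , _) ∣G∩∁G′∣≡0 =
    cong 𝓐 (∣p∩∁q∣≡0⇒p≡q G G′ (trans ∣G∣≡v (sym ∣G′∣≡v)) ∣G∩∁G′∣≡0)
  critical𝓐-same-status (suc d) G G′ G-critical G′-critical ∣G∩∁G′∣≡1+d =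
    let x , y , G″-critical , ∣G″∩∁G′∣≡d = critical-exchange G-critical G′-critical ∣G∩∁G′∣≡1+d
    in  trans (exchange-preserves-status G x y G-critical G″-critical)
              (critical𝓐-same-status d (G [ x ↦ y ]) G′ G″-critical G′-critical ∣G″∩∁G′∣≡d)

  B₀-exists : ∃[ B ] Critical𝓑 B
  B₀-exists =
    let W , ⁅i⁆⊆W , W⊆T , ∣W∣≡s = subset-between ⁅ i ⁆ T s (⁅x⁆⊆p i∈T) ∣⁅i⁆∣≤s s≤∣T∣
        B , B-critical , _ = extend-to-critical l′ W ⊥ m≤N T⊆[m] W⊆T (⁅i⁆⊆W (x∈⁅x⁆ i)) ∣W∣≡s
                               (room𝓑 ⊥ ∣T∪⊥∣≤∣T∣+k′+1)
    in  B , B-critical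
    where
    ∣⁅i⁆∣≤s : ∣ ⁅ i ⁆ ∣ ≤ s
    ∣⁅i⁆∣≤s = subst (_≤ s) (sym (∣⁅x⁆∣≡1 i)) (≤-trans (≤-trans (s≤s z≤n) 2≤t) (m≤m+n t r))
    s≤∣T∣ : s ≤ ∣ T ∣
    s≤∣T∣ = ≤-trans (m≤m+n s r) (≤-reflexive s+r≡∣T∣)
    ∣T∪⊥∣≤∣T∣+k′+1 : ∣ T ∪ ⊥ ∣ ≤ ∣ T ∣ + k′ + 1
    ∣T∪⊥∣≤∣T∣+k′+1 = ≤-trans (≤-reflexive (cong ∣_∣ (∪-identityʳ T))) (≤-trans (m≤m+n ∣ T ∣ k′) (m≤m+n _ 1))

  G₀-exists : ∃[ G ] Critical𝓐 G
  G₀-exists = let G , G-critical , _ = critical𝓐-neighbour (proj₁ B₀-exists) (proj₂ B₀-exists) in G , G-critical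

  B₀ G₀ : Subset N
  B₀ = proj₁ B₀-exists
  G₀ = proj₁ G₀-exists

  B₀-critical : Critical𝓑 B₀
  B₀-critical = proj₂ B₀-exists

  G₀-critical : Critical𝓐 G₀
  G₀-critical = proj₂ G₀-exists

  critical𝓐-status : ∀ G → Critical𝓐 G → 𝓐 G ≡ 𝓐 G₀
  critical𝓐-status G G-critical = critical𝓐-same-status _ G G₀ G-critical G₀-critical refl

  critical𝓑-status : ∀ B → Critical𝓑 B → 𝓑 B ≡ 𝓐 G₀
  critical𝓑-status B B-critical =
    let G , G-critical , ∣G∩B∣≤t = critical𝓐-neighbour B B-critical
    in  trans (sym (close⇒same-status G B G-critical B-critical ∣G∩B∣≤t)) (critical𝓐-status G G-critical)

  Unshifted : Set
  Unshifted = Σ (Subset N) λ T′ → ∣ T′ ∣ ≡ t + 2 * r × InRange (m ⊓ n) T′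
              × (∀ A → A ∈F 𝓐 ⇔ InHilton n (s + k′) T′ s A) × (∀ B → B ∈F 𝓑 ⇔ InHilton m (s + l′) T′ s B)

  unshifted-by-status : ∀ b → 𝓐 G₀ ≡ b → Unshifted
  unshifted-by-status true G₀∈𝓐 = T , ∣T∣≡t+2r , T⊆[m⊓n]
    , Shifted𝓐.𝓕≡𝓗-if-critical∈ (λ G G-critical → trans (critical𝓐-status G G-critical) G₀∈𝓐)
    , Shifted𝓑.𝓕≡𝓗-if-critical∈ (λ B B-critical → trans (critical𝓑-status B B-critical) G₀∈𝓐)
  unshifted-by-status false G₀∉𝓐 = T [ i ↦ j ] , trans (∣p[x↦y]∣≡∣p∣ T i∈T j∉T) ∣T∣≡t+2r
    , InRange-[↦] T T⊆[m⊓n] (⊓-glb j<m j<n)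
    , Shifted𝓐.𝓕≡𝓗[i↦j]-if-critical∉ i∈T j∉T (λ G G-critical → trans (critical𝓐-status G G-critical) G₀∉𝓐)
    , Shifted𝓑.𝓕≡𝓗[i↦j]-if-critical∉ i∈T j∉T (λ B B-critical → trans (critical𝓑-status B B-critical) G₀∉𝓐)
    where
    j<n : toℕ j ℕ.< n
    j<n = proj₁ (𝓐⊆binom _ (proj₂ (Shifted𝓐.missing⇒critical G₀ (Critical⇒Hilton G₀-critical) G₀∉𝓐)))
                j (y∈p[x↦y] G₀ i j)
    j<m : toℕ j ℕ.< m
    j<m = proj₁ (𝓑⊆binom _ (proj₂ (Shifted𝓑.missing⇒critical B₀ (Critical⇒Hilton B₀-critical)
                  (trans (critical𝓑-status B₀ B₀-critical) G₀∉𝓐))))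
                j (y∈p[x↦y] B₀ i j)

  -- A with-abstraction over 𝓐 G₀ would make Agda normalise the construction of G₀, at prohibitive cost.
  unshifted : Unshifted
  unshifted = unshifted-by-status (𝓐 G₀) refl

k+l∸t+2≡t+2r+k′+l′+2 : ∀ t r k′ l′ → t + r + k′ + (t + r + l′) ∸ t + 2 ≡ t + 2 * r + k′ + l′ + 2
k+l∸t+2≡t+2r+k′+l′+2 t r k′ l′ = begin
  t + r + k′ + (t + r + l′) ∸ t + 2    ≡⟨ cong (λ a → a ∸ t + 2) (lemma₁ t r k′ l′) ⟩
  t + (r + k′ + (t + r + l′)) ∸ t + 2  ≡⟨ cong (_+ 2) (m+n∸m≡n t _) ⟩
  r + k′ + (t + r + l′) + 2            ≡⟨ lemma₂ t r k′ l′ ⟩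
  t + 2 * r + k′ + l′ + 2              ∎
  where
  open ≡-Reasoning
  lemma₁ : ∀ t r k′ l′ → t + r + k′ + (t + r + l′) ≡ t + (r + k′ + (t + r + l′))
  lemma₁ = solve-∀
  lemma₂ : ∀ t r k′ l′ → r + k′ + (t + r + l′) + 2 ≡ t + 2 * r + k′ + l′ + 2
  lemma₂ = solve-∀

theorem4p5 : (m n k l t r : ℕ) → 1 ≤ m → 1 ≤ n → 1 ≤ k → 1 ≤ l → 1 ≤ r →
    2 ≤ t → l ≤ k → t + r ≤ l → k + l ∸ t + 2 ≤ m ⊓ n →
    (i j : Fin (m ⊔ n)) → i < j →
    (𝓐 𝓑 : Family (m ⊔ n)) →
    (∀ A → A ∈F 𝓐 → InBinom n k A) →
    (∀ B → B ∈F 𝓑 → InBinom m l B) →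
    CrossInt t 𝓐 𝓑 →
    (Σ (Subset (m ⊔ n)) λ T → ∣ T ∣ ≡ t + 2 * r × InRange (m ⊓ n) T
      × (∀ A → (A ∈Shift[ i , j ] 𝓐) ⇔ InHilton n k T (t + r) A)
      × (∀ B → (B ∈Shift[ i , j ] 𝓑) ⇔ InHilton m l T (t + r) B)) →
    Σ (Subset (m ⊔ n)) λ T' → ∣ T' ∣ ≡ t + 2 * r × InRange (m ⊓ n) T'
      × (∀ A → A ∈F 𝓐 ⇔ InHilton n k T' (t + r) A)
      × (∀ B → B ∈F 𝓑 ⇔ InHilton m l T' (t + r) B)
theorem4p5 m n k l t r _ _ _ _ _ 2≤t l≤k t+r≤l room i j i<j 𝓐 𝓑 𝓐⊆binom 𝓑⊆binom cross
           (T , ∣T∣≡t+2r , T⊆[m⊓n] , S𝓐≡𝓗 , S𝓑≡𝓗) with x∈p×y∉p⊎x∈p⇒y∈p i j T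
... | inj₂ i∈T⇒j∈T =
  T , ∣T∣≡t+2r , T⊆[m⊓n] , ShiftedHilton.𝓕≡𝓗-if-i∈T⇒j∈T i j i<j T (t + r) n k 𝓐 𝓐⊆binom S𝓐≡𝓗 i∈T⇒j∈T
                         , ShiftedHilton.𝓕≡𝓗-if-i∈T⇒j∈T i j i<j T (t + r) m l 𝓑 𝓑⊆binom S𝓑≡𝓗 i∈T⇒j∈T
... | inj₁ (i∈T , j∉T) with m≤n⇒∃[o]m+o≡n (≤-trans t+r≤l l≤k) | m≤n⇒∃[o]m+o≡n t+r≤l
...   | k′ , refl | l′ , refl =
  HiltonPair.unshifted i j i<j T t r k′ l′ m n 2≤t (m≤m⊔n m n) (m≤n⊔m m n) ∣T∣≡t+2r T⊆[m⊓n] i∈T j∉T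
    (subst (_≤ m ⊓ n) (trans (k+l∸t+2≡t+2r+k′+l′+2 t r k′ l′) (cong (λ a → a + k′ + l′ + 2) (sym ∣T∣≡t+2r))) room)
    𝓐 𝓑 𝓐⊆binom 𝓑⊆binom cross S𝓐≡𝓗 S𝓑≡𝓗
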